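{- Let $w\in\{\mathtt{0},\mathtt{1}\}^*$. The area statistics over the set of perfect matchings of the snake graph $G(w)$ satisfies \[ \left(\begin{array}{r} \sum_{m\in M^{\perp}(w)} q^{\mathrm{area}(m\Delta\mathfrak{b})}\\ \sum_{m\in M^{\parallel}(w)} q^{\mathrm{area}(m\Delta\mathfrak{b})} \end{array}\right) = \left(\begin{smallmatrix} 1 & 0 \\ 0 & q \end{smallmatrix}\right)^{ -1} \nu_q(\theta(w)) \left(\begin{array}{c} q \\ q \end{array}\right), \] where $\mathfrak{b}$ is the basic perfect matching of the snake graph $G(w)$.
   Context: $q$ is an indeterminate; $\nu_q$ is the monoid homomorphism $\{\mathtt{0},\mathtt{1}\}^*\to\mathrm{GL}_2(\mathbb{Z}[q^{\pm1}])$ with $\nu_q(\mathtt{0})=\left(\begin{smallmatrix} q & 0\\ q & 1\end{smallmatrix}\right)$, $\nu_q(\mathtt{1})=\left(\begin{smallmatrix} q & 1\\ 0 & 1\end{smallmatrix}\right)$. The involution $\theta$ on $\{\mathtt{0},\mathtt{1}\}^*$ is defined by $\theta(\varepsilon)=\varepsilon$, $\theta(\alpha w)=\overline{\alpha}\theta(w)$ if $|w|$ is even and $\alpha\theta(w)$ if $|w|$ is odd ($\overline{\mathtt{0}}=\mathtt{1}$, $\overline{\mathtt{1}}=\mathtt{0}$). The snake graph $G(w)$ is the union of the unit squares (with their four edges) at the points $(|p|_\mathtt{0},|p|_\mathtt{1})$ for all prefixes $p$ of $w$. The basic matching $\mathfrak{b}$ is the perfect matching of $G(w)$ using only boundary edges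 whose last edge (containing the top-right vertex) is vertical. A perfect matching is a $\perp$-matching if ($|w|$ even and its first edge, containing $(0,0)$, is horizontal) or ($|w|$ odd and its first edge is vertical); otherwise it is a $\parallel$-matching; $M^\perp(w)$, $M^\parallel(w)$ denote these sets. $\mathrm{area}(m\Delta\mathfrak{b})$ is the area of the region enclosed by the cycles of the symmetric difference $m\Delta\mathfrak{b}$. -}

module Defs where

open import Data.Bool using (Bool; true; false; not; _∧_; _∨_; _xor_; if_then_else_)
open import Data.Nat using (ℕ; zero; suc; _≡ᵇ_; _<ᵇ_; _%_)
open import Data.Nat.Properties using () renaming (_≟_ to _≟ℕ_)
open import Data.Product using (_×_; _,_; proj₁; proj₂)
open import Data.Product.Properties using (≡-dec)
open import Data.Bool.ListAction using (any; all)
open import Data.List using (List; []; _∷_; _++_; map; concatMap; length; filterᵇ; deduplicate; foldr; upTo; cartesianProduct)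
open import Relation.Binary.PropositionalEquality using (_≡_; refl; cong; cong₂)
open import Relation.Nullary using (Dec; yes; no; ⌊_⌋)
open import Algebra.Bundles using (CommutativeRing)

data Letter : Set where
  𝟎 𝟏 : Letter

Word : Set
Word = List Letter

flipL : Letter → Letter
flipL 𝟎 = 𝟏
flipL 𝟏 = 𝟎

isEven : ℕ → Bool
isEven n = n % 2 ≡ᵇ 0

count0 : Word → ℕ
count0 [] = 0
count0 (𝟎 ∷ w) = suc (count0 w)
count0 (𝟏 ∷ w) = count0 w

count1 : Word → ℕ
count1 [] = 0
count1 (𝟎 ∷ w) = count1 w
count1 (𝟏 ∷ w) = suc (count1 w)

θ : Word → Word
θ [] = []
θ (α ∷ w) = if isEven (length w) then flipL α ∷ θ w else α ∷ θ w

Point : Set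
Point = ℕ × ℕ

_≟P_ : (p p′ : Point) → Dec (p ≡ p′)
_≟P_ = ≡-dec _≟ℕ_ _≟ℕ_

-- (|p|_0, |p|_1) for all prefixes p of w (lower-left corners of the squares)
squares : Word → List Point
squares [] = (0 , 0) ∷ []
squares (𝟎 ∷ w) = (0 , 0) ∷ map (λ p → suc (proj₁ p) , proj₂ p) (squares w)
squares (𝟏 ∷ w) = (0 , 0) ∷ map (λ p → proj₁ p , suc (proj₂ p)) (squares w)

-- unit edges of the integer lattice:
-- H x y joins (x,y)-(x+1,y);  V x y joins (x,y)-(x,y+1)
data Edge : Set where
  H V : ℕ → ℕ → Edge

_≟E_ : (e e′ : Edge) → Dec (e ≡ e′)
H x y ≟E H x′ y′ with x ≟ℕ x′ | y ≟ℕ y′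
... | yes refl | yes refl = yes refl
... | no ne | _ = no λ { refl → ne refl }
... | yes _ | no ne = no λ { refl → ne refl }
H _ _ ≟E V _ _ = no λ ()
V _ _ ≟E H _ _ = no λ ()
V x y ≟E V x′ y′ with x ≟ℕ x′ | y ≟ℕ y′
... | yes refl | yes refl = yes refl
... | no ne | _ = no λ { refl → ne refl }
... | yes _ | no ne = no λ { refl → ne refl }

_∈ᵇ_ : Edge → List Edge → Bool
e ∈ᵇ es = any (λ e′ → ⌊ e ≟E e′ ⌋) es

sqEdges : Point → List Edge
sqEdges (a , b) = H a b ∷ H a (suc b) ∷ V a b ∷ V (suc a) b ∷ []

corners : Point → List Point
corners (a , b) = (a , b) ∷ (suc a , b) ∷ (a , suc b) ∷ (suc a , suc b) ∷ []

edgesG : Word → List Edge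
edgesG w = deduplicate _≟E_ (concatMap sqEdges (squares w))

vertsG : Word → List Point
vertsG w = deduplicate _≟P_ (concatMap corners (squares w))

incident : Point → Edge → Bool
incident v (H x y) = ⌊ v ≟P (x , y) ⌋ ∨ ⌊ v ≟P (suc x , y) ⌋
incident v (V x y) = ⌊ v ≟P (x , y) ⌋ ∨ ⌊ v ≟P (x , suc y) ⌋

subsets : {A : Set} → List A → List (List A)
subsets [] = [] ∷ []
subsets (x ∷ xs) = map (x ∷_) (subsets xs) ++ subsets xs

isPerfect : Word → List Edge → Bool
isPerfect w m = all (λ v → length (filterᵇ (incident v) m) ≡ᵇ 1) (vertsG w)

matchings : Word → List (List Edge)
matchings w = filterᵇ (isPerfect w) (subsets (edgesG w))

isBoundary : Word → Edge → Bool
isBoundary w e = length (filterᵇ (λ s → e ∈ᵇ sqEdges s) (squares w)) ≡ᵇ 1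

-- the unique edge of m at (0,0) decides ⊥ / ∥
isPerp : Word → List Edge → Bool
isPerp w m = if isEven (length w) then H 0 0 ∈ᵇ m else V 0 0 ∈ᵇ m

M⊥ : Word → List (List Edge)
M⊥ w = filterᵇ (isPerp w) (matchings w)

M∥ : Word → List (List Edge)
M∥ w = filterᵇ (λ m → not (isPerp w m)) (matchings w)

symDiff : Word → List Edge → List Edge → List Edge
symDiff w m b = filterᵇ (λ e → (e ∈ᵇ m) xor (e ∈ᵇ b)) (edgesG w)

-- number of edges of D crossed by the horizontal ray going right from
-- the centre (a+1/2, c+1/2) of the unit cell with lower-left corner (a,c)
crossings : Point → List Edge → ℕ
crossings (a , c) D = length (filterᵇ crosses D)
  where
  crosses : Edge → Bool
  crosses (H _ _) = false
  crosses (V x y) = (y ≡ᵇ c) ∧ (a <ᵇ x)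

cellsBox : Word → List Point
cellsBox w = cartesianProduct (upTo (suc (suc (length w)))) (upTo (suc (suc (length w))))

-- number of unit cells enclosed by the cycles of D (even–odd rule)
area : Word → List Edge → List Edge → ℕ
area w m b = length (filterᵇ (λ p → not (isEven (crossings p (symDiff w m b)))) (cellsBox w))

-- basic matching 𝔟: a perfect matching using only boundary edges whose
-- edge at the top-right vertex (|w|_0+1, |w|_1+1) is vertical

open import Data.List.Membership.Propositional using (_∈_)
open import Data.List.Relation.Unary.All using (All)
open import Data.Bool using (T)

record IsBasicMatching (w : Word) (b : List Edge) : Set where
  field
    perfect  : b ∈ matchings w
    boundary : All (λ e → T (isBoundary w e)) b
    lastVert : V (suc (count0 w)) (count1 w) ∈ b

module OverRing {r ℓ} (R : CommutativeRing r ℓ) where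
  open CommutativeRing R

  pow : Carrier → ℕ → Carrier
  pow q zero = 1#
  pow q (suc n) = q * pow q n

  record M2 : Set r where
    constructor mat
    field a b c d : Carrier

  _·_ : M2 → M2 → M2
  mat a b c d · mat a′ b′ c′ d′ =
    mat (a * a′ + b * c′) (a * b′ + b * d′) (c * a′ + d * c′) (c * b′ + d * d′)

  _▹_ : M2 → Carrier × Carrier → Carrier × Carrier
  mat a b c d ▹ (x , y) = (a * x + b * y) , (c * x + d * y)

  I2 : M2
  I2 = mat 1# 0# 0# 1#

  νL : Carrier → Letter → M2
  νL q 𝟎 = mat q 0# q 1#
  νL q 𝟏 = mat q 1# 0# 1#

  ν : Carrier → Word → M2
  ν q = foldr (λ α M → νL q α · M) I2

  areaSum : Carrier → Word → List Edge → List (List Edge) → Carrier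
  areaSum q w b ms = foldr (λ m s → pow q (area w m b) + s) 0# ms

  rhs : Carrier → Carrier → Word → Carrier × Carrier
  rhs q q⁻¹ w = mat 1# 0# 0# q⁻¹ ▹ (ν q (θ w) ▹ (q , q))

{-# OPTIONS --safe #-}
module Submission where

-- Induction on w, peeling off the first square of the snake graph.  A perfect
-- matching of G(αw) covers that square either by a single edge (V00 if α = 𝟎,
-- H00 if α = 𝟏), and then restricts to an arbitrary perfect matching of the
-- shifted G(w), or by the two opposite edges, and then its restriction plus the
-- first edge of G(w) is a perfect matching of G(w) of one fixed class r.  The
-- first cell is enclosed by m Δ 𝔟 exactly when m and 𝔟 differ on V00 (α = 𝟎) or
-- V10 (α = 𝟏); all other enclosed cells are those of the restrictions, because
-- in every perfect matching the number of vertical edges in a given row has the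
-- same parity.  With T_t the class sums (t = true for ⊥) and r as above,
--   T_{¬r}(αw) = q^[¬r] (T_⊥(w) + T_∥(w)),   T_r(αw) = q^[r] T_r(w),
-- i.e. (T_⊥, q T_∥)(αw) = ν_q(x) (T_⊥, q T_∥)(w), where x is the first letter of
-- θ(αw); the single square contributes (q, q).

open import Defs
open import Algebra.Bundles using (CommutativeRing)
open import Data.List using (List)
open import Data.Bool using (true; false)
open import Data.Product using (_×_; _,_; proj₁; proj₂)

module Matchings where

  open import Data.Bool using (Bool; true; false; not; _∧_; _∨_; _xor_; if_then_else_; T)
  open import Data.Bool.Properties
    using (not-involutive; ¬-not; T-≡; xor-same; xor-inverseˡ; xor-inverseʳ; ∧-zeroʳ; ∧-identityʳ; ∨-identityʳ; ∨-zeroʳ;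
           xor-identityʳ; xor-∧-commutativeRing)
  open import Algebra.Properties.CommutativeSemigroup (CommutativeRing.+-commutativeSemigroup xor-∧-commutativeRing)
    using () renaming (interchange to xor-interchange)
  open CommutativeRing xor-∧-commutativeRing using () renaming (distribʳ to ∧-distribʳ-xor)
  open import Data.Bool.ListAction using (all)
  open import Data.Empty using (⊥; ⊥-elim)
  open import Data.List using ([]; _∷_; _++_; map; length; filterᵇ; concatMap; upTo; applyUpTo; cartesianProductWith)
  open import Data.List.Properties using (map-++; map-cong; map-∘)
  open import Data.List.Membership.Propositional using (_∈_; _∉_)
  open import Data.List.Membership.Propositional.Properties
    using (∈-map⁺; ∈-map⁻; ∈-++⁺ʳ; ∈-++⁻; ∈-filter⁻; ∈-deduplicate⁻; ∈-deduplicate⁺)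
  open import Data.List.Membership.Propositional.Properties.WithK using (unique∧set⇒bag)
  open import Data.List.Relation.Binary.BagAndSetEquality using (∼bag⇒↭)
  open import Data.List.Relation.Binary.Permutation.Propositional as ↭ using (_↭_)
  import Data.List.Relation.Binary.Permutation.Propositional.Properties as ↭
  open import Data.List.Relation.Unary.All as All using (All; []; _∷_)
  import Data.List.Relation.Unary.All.Properties as All
  open import Data.List.Relation.Unary.AllPairs using ([]; _∷_)
  open import Data.List.Relation.Unary.Any using (here; there)
  open import Data.List.Relation.Unary.Unique.Propositional using (Unique)
  import Data.List.Relation.Unary.Unique.Propositional.Properties as Unique
  open import Data.List.Relation.Unary.Unique.DecPropositional.Properties _≟E_ using (deduplicate-!)
  open import Data.Nat using (ℕ; zero; suc; _+_; _%_; _≡ᵇ_; _<ᵇ_; _≤_; _<_; z≤n; s≤s)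
  open import Data.Nat.DivMod using ([m+n]%n≡m%n)
  open import Data.Nat.ListAction using (sum)
  open import Data.Nat.ListAction.Properties using (sum-++; sum-↭)
  open import Data.Nat.Properties
    using (+-comm; +-assoc; +-identityʳ; ≡ᵇ⇒≡; m≤n⇒m≤1+n; ≤-trans; ≤-reflexive; m≤n+m; +-commutativeSemigroup)
  open import Algebra.Properties.CommutativeSemigroup +-commutativeSemigroup
    using () renaming (x∙yz≈y∙xz to +-leftComm; interchange to +-interchange)
  open import Data.Product using (Σ-syntax)
  open import Data.Sum using (_⊎_; inj₁; inj₂)
  open import Data.Unit using (⊤; tt)
  open import Function using (_∘_)
  open import Function.Bundles using (mk⇔; Equivalence)
  open import Relation.Binary.Definitions using (DecidableEquality)
  open import Relation.Binary.PropositionalEquality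
  open import Relation.Nullary using (yes; no; ⌊_⌋; ¬_)
  open import Relation.Nullary.Decidable using (T?)

  bit : Bool → ℕ
  bit true = 1
  bit false = 0

  isOdd : ℕ → Bool
  isOdd zero = false
  isOdd (suc n) = not (isOdd n)

  isOdd-bit+ : ∀ b n → isOdd (bit b + n) ≡ b xor isOdd n
  isOdd-bit+ true n = refl
  isOdd-bit+ false n = refl

  isEven-suc-suc : ∀ n → isEven (suc (suc n)) ≡ isEven n
  isEven-suc-suc n = cong (_≡ᵇ 0) (trans (cong (_% 2) (+-comm 2 n)) ([m+n]%n≡m%n n 2))

  isEven≡not-isOdd : ∀ n → isEven n ≡ not (isOdd n)
  isEven≡not-isOdd zero = refl
  isEven≡not-isOdd (suc zero) = refl
  isEven≡not-isOdd (suc (suc n)) =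
    trans (isEven-suc-suc n) (trans (isEven≡not-isOdd n) (cong not (sym (not-involutive (isOdd n)))))

  isEven-suc : ∀ n → isEven (suc n) ≡ not (isEven n)
  isEven-suc n = trans (isEven≡not-isOdd (suc n)) (cong not (sym (isEven≡not-isOdd n)))

  count : {A : Set} → (A → Bool) → List A → ℕ
  count p xs = sum (map (λ x → bit (p x)) xs)

  module _ {A : Set} where

    count-cong : ∀ {p p′ : A → Bool} → (∀ x → p x ≡ p′ x) → ∀ xs → count p xs ≡ count p′ xs
    count-cong p≗p′ xs = cong sum (map-cong (cong bit ∘ p≗p′) xs)

    count-congᴸ : ∀ {p p′ : A → Bool} xs → (∀ {x} → x ∈ xs → p x ≡ p′ x) → count p xs ≡ count p′ xs
    count-congᴸ [] _ = refl
    count-congᴸ (x ∷ xs) p≗p′ = cong₂ _+_ (cong bit (p≗p′ (here refl))) (count-congᴸ xs (p≗p′ ∘ there))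

    count-none : ∀ {p : A → Bool} → (∀ x → p x ≡ false) → ∀ xs → count p xs ≡ 0
    count-none p≗false [] = refl
    count-none p≗false (x ∷ xs) rewrite p≗false x = count-none p≗false xs

    count-map : ∀ {B : Set} (f : B → A) (p : A → Bool) xs → count p (map f xs) ≡ count (p ∘ f) xs
    count-map f p xs = cong sum (sym (map-∘ xs))

    count-++ : ∀ (p : A → Bool) xs ys → count p (xs ++ ys) ≡ count p xs + count p ys
    count-++ p xs ys = trans (cong sum (map-++ (bit ∘ p) xs ys)) (sum-++ (map (bit ∘ p) xs) _)

    count-↭ : ∀ (p : A → Bool) {xs ys} → xs ↭ ys → count p xs ≡ count p ys
    count-↭ p xs↭ys = sum-↭ (↭.map⁺ (bit ∘ p) xs↭ys)

    length-filterᵇ : ∀ (p : A → Bool) xs → length (filterᵇ p xs) ≡ count p xs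
    length-filterᵇ p [] = refl
    length-filterᵇ p (x ∷ xs) with p x
    ... | true = cong suc (length-filterᵇ p xs)
    ... | false = length-filterᵇ p xs

    count-filterᵇ : ∀ (p P : A → Bool) xs → count p (filterᵇ P xs) ≡ count (λ x → P x ∧ p x) xs
    count-filterᵇ p P [] = refl
    count-filterᵇ p P (x ∷ xs) with P x
    ... | true = cong (bit (p x) +_) (count-filterᵇ p P xs)
    ... | false = count-filterᵇ p P xs

    isOdd-count-xor : ∀ (p p′ : A → Bool) xs →
      isOdd (count (λ x → p x xor p′ x) xs) ≡ isOdd (count p xs) xor isOdd (count p′ xs)
    isOdd-count-xor p p′ [] = refl
    isOdd-count-xor p p′ (x ∷ xs)
      rewrite isOdd-bit+ (p x xor p′ x) (count (λ x → p x xor p′ x) xs)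
            | isOdd-bit+ (p x) (count p xs) | isOdd-bit+ (p′ x) (count p′ xs)
            | isOdd-count-xor p p′ xs = xor-interchange (p x) (p′ x) (isOdd (count p xs)) (isOdd (count p′ xs))

  _==ᴾ_ : Point → Point → Bool
  (a , b) ==ᴾ (c , d) = (a ≡ᵇ c) ∧ (b ≡ᵇ d)

  _==ᴱ_ : Edge → Edge → Bool
  H a b ==ᴱ H c d = (a ≡ᵇ c) ∧ (b ≡ᵇ d)
  H _ _ ==ᴱ V _ _ = false
  V _ _ ==ᴱ H _ _ = false
  V a b ==ᴱ V c d = (a ≡ᵇ c) ∧ (b ≡ᵇ d)

  ≡ᵇ-refl : ∀ n → (n ≡ᵇ n) ≡ true
  ≡ᵇ-refl zero = refl
  ≡ᵇ-refl (suc n) = ≡ᵇ-refl n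

  ≡ᵇ-sound : ∀ m n → (m ≡ᵇ n) ≡ true → m ≡ n
  ≡ᵇ-sound m n eq = ≡ᵇ⇒≡ m n (subst T (sym eq) _)

  ∧-≡ᵇ-sound : ∀ {a b c d} → ((a ≡ᵇ c) ∧ (b ≡ᵇ d)) ≡ true → a ≡ c × b ≡ d
  ∧-≡ᵇ-sound {a} {b} {c} {d} eq with a ≡ᵇ c in eq₁
  ... | true = ≡ᵇ-sound a c eq₁ , ≡ᵇ-sound b d eq

  module _ {A : Set} (_≟_ : DecidableEquality A) (_==_ : A → A → Bool)
           (==-refl : ∀ x → (x == x) ≡ true) (==-sound : ∀ x y → (x == y) ≡ true → x ≡ y) where

    ⌊≟⌋≡== : ∀ x y → ⌊ x ≟ y ⌋ ≡ (x == y)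
    ⌊≟⌋≡== x y with x ≟ y | x == y in eq
    ... | yes refl | _ = trans (sym (==-refl x)) eq
    ... | no _ | false = refl
    ... | no x≢y | true = ⊥-elim (x≢y (==-sound x y eq))

  ⌊≟P⌋≡==ᴾ : ∀ p p′ → ⌊ p ≟P p′ ⌋ ≡ (p ==ᴾ p′)
  ⌊≟P⌋≡==ᴾ = ⌊≟⌋≡== _≟P_ _==ᴾ_ refl′ sound
    where
    refl′ : ∀ p → (p ==ᴾ p) ≡ true
    refl′ (a , b) rewrite ≡ᵇ-refl a | ≡ᵇ-refl b = refl
    sound : ∀ p p′ → (p ==ᴾ p′) ≡ true → p ≡ p′
    sound (a , b) (c , d) eq with ∧-≡ᵇ-sound {a} {b} eq
    ... | refl , refl = refl

  ⌊≟E⌋≡==ᴱ : ∀ e e′ → ⌊ e ≟E e′ ⌋ ≡ (e ==ᴱ e′)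
  ⌊≟E⌋≡==ᴱ = ⌊≟⌋≡== _≟E_ _==ᴱ_ refl′ sound
    where
    refl′ : ∀ e → (e ==ᴱ e) ≡ true
    refl′ (H a b) rewrite ≡ᵇ-refl a | ≡ᵇ-refl b = refl
    refl′ (V a b) rewrite ≡ᵇ-refl a | ≡ᵇ-refl b = refl
    sound : ∀ e e′ → (e ==ᴱ e′) ≡ true → e ≡ e′
    sound (H a b) (H c d) eq with ∧-≡ᵇ-sound {a} {b} eq
    ... | refl , refl = refl
    sound (V a b) (V c d) eq with ∧-≡ᵇ-sound {a} {b} eq
    ... | refl , refl = refl

  east north : Edge → Edge
  east (H x y) = H (suc x) y
  east (V x y) = V (suc x) y
  north (H x y) = H x (suc y)
  north (V x y) = V x (suc y)

  eastᵖ northᵖ : Point → Point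
  eastᵖ (x , y) = suc x , y
  northᵖ (x , y) = x , suc y

  edgeList : Word → List Edge
  edgeList [] = H 0 0 ∷ H 0 1 ∷ V 0 0 ∷ V 1 0 ∷ []
  edgeList (𝟎 ∷ w) = H 0 0 ∷ H 0 1 ∷ V 0 0 ∷ map east (edgeList w)
  edgeList (𝟏 ∷ w) = H 0 0 ∷ V 0 0 ∷ V 1 0 ∷ map north (edgeList w)

  vertexList : Word → List Point
  vertexList [] = (0 , 0) ∷ (1 , 0) ∷ (0 , 1) ∷ (1 , 1) ∷ []
  vertexList (𝟎 ∷ w) = (0 , 0) ∷ (0 , 1) ∷ map eastᵖ (vertexList w)
  vertexList (𝟏 ∷ w) = (0 , 0) ∷ (1 , 0) ∷ map northᵖ (vertexList w)

  concatMap-map-shift : ∀ {A B : Set} {f : A → A} {g : A → List B} {h : B → B} →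
    (∀ a → g (f a) ≡ map h (g a)) → ∀ as → concatMap g (map f as) ≡ map h (concatMap g as)
  concatMap-map-shift g∘f≡ [] = refl
  concatMap-map-shift {g = g} {h} g∘f≡ (a ∷ as) =
    trans (cong₂ _++_ (g∘f≡ a) (concatMap-map-shift g∘f≡ as)) (sym (map-++ h (g a) _))

  squareEdges : Word → List Edge
  squareEdges w = concatMap sqEdges (squares w)

  squareEdges-𝟎 : ∀ w → squareEdges (𝟎 ∷ w) ≡ sqEdges (0 , 0) ++ map east (squareEdges w)
  squareEdges-𝟎 w = cong (sqEdges (0 , 0) ++_) (concatMap-map-shift (λ _ → refl) (squares w))

  squareEdges-𝟏 : ∀ w → squareEdges (𝟏 ∷ w) ≡ sqEdges (0 , 0) ++ map north (squareEdges w)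
  squareEdges-𝟏 w = cong (sqEdges (0 , 0) ++_) (concatMap-map-shift (λ _ → refl) (squares w))

  squareCorners : Word → List Point
  squareCorners w = concatMap corners (squares w)

  squareCorners-𝟎 : ∀ w → squareCorners (𝟎 ∷ w) ≡ corners (0 , 0) ++ map eastᵖ (squareCorners w)
  squareCorners-𝟎 w = cong (corners (0 , 0) ++_) (concatMap-map-shift (λ _ → refl) (squares w))

  squareCorners-𝟏 : ∀ w → squareCorners (𝟏 ∷ w) ≡ corners (0 , 0) ++ map northᵖ (squareCorners w)
  squareCorners-𝟏 w = cong (corners (0 , 0) ++_) (concatMap-map-shift (λ _ → refl) (squares w))

  H00∈edgeList : ∀ w → H 0 0 ∈ edgeList w
  H00∈edgeList [] = here refl
  H00∈edgeList (𝟎 ∷ w) = here refl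
  H00∈edgeList (𝟏 ∷ w) = here refl

  V00∈edgeList : ∀ w → V 0 0 ∈ edgeList w
  V00∈edgeList [] = there (there (here refl))
  V00∈edgeList (𝟎 ∷ w) = there (there (here refl))
  V00∈edgeList (𝟏 ∷ w) = there (here refl)

  origin∈vertexList : ∀ w → (0 , 0) ∈ vertexList w
  origin∈vertexList [] = here refl
  origin∈vertexList (𝟎 ∷ w) = here refl
  origin∈vertexList (𝟏 ∷ w) = here refl

  01∈vertexList : ∀ w → (0 , 1) ∈ vertexList w
  01∈vertexList [] = there (there (here refl))
  01∈vertexList (𝟎 ∷ w) = there (here refl)
  01∈vertexList (𝟏 ∷ w) = there (there (∈-map⁺ northᵖ (origin∈vertexList w)))

  10∈vertexList : ∀ w → (1 , 0) ∈ vertexList w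
  10∈vertexList [] = there (here refl)
  10∈vertexList (𝟎 ∷ w) = there (there (∈-map⁺ eastᵖ (origin∈vertexList w)))
  10∈vertexList (𝟏 ∷ w) = there (here refl)

  edgeList⊆squareEdges : ∀ w {e} → e ∈ edgeList w → e ∈ squareEdges w
  edgeList⊆squareEdges [] e∈ = e∈
  edgeList⊆squareEdges (𝟎 ∷ w) e∈ rewrite squareEdges-𝟎 w with e∈
  ... | here p = here p
  ... | there (here p) = there (here p)
  ... | there (there (here p)) = there (there (here p))
  ... | there (there (there e∈′)) with ∈-map⁻ east e∈′
  ...   | _ , e′∈ , refl = ∈-++⁺ʳ (sqEdges (0 , 0)) (∈-map⁺ east (edgeList⊆squareEdges w e′∈))
  edgeList⊆squareEdges (𝟏 ∷ w) e∈ rewrite squareEdges-𝟏 w with e∈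
  ... | here p = here p
  ... | there (here p) = there (there (here p))
  ... | there (there (here p)) = there (there (there (here p)))
  ... | there (there (there e∈′)) with ∈-map⁻ north e∈′
  ...   | _ , e′∈ , refl = ∈-++⁺ʳ (sqEdges (0 , 0)) (∈-map⁺ north (edgeList⊆squareEdges w e′∈))

  squareEdges⊆edgeList : ∀ w {e} → e ∈ squareEdges w → e ∈ edgeList w
  squareEdges⊆edgeList [] e∈ = e∈
  squareEdges⊆edgeList (𝟎 ∷ w) e∈ rewrite squareEdges-𝟎 w with ∈-++⁻ (sqEdges (0 , 0)) e∈
  ... | inj₁ (here p) = here p
  ... | inj₁ (there (here p)) = there (here p)
  ... | inj₁ (there (there (here p))) = there (there (here p))
  ... | inj₁ (there (there (there (here refl)))) = there (there (there (∈-map⁺ east (V00∈edgeList w))))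
  ... | inj₂ e∈′ with ∈-map⁻ east e∈′
  ...   | _ , e′∈ , refl = there (there (there (∈-map⁺ east (squareEdges⊆edgeList w e′∈))))
  squareEdges⊆edgeList (𝟏 ∷ w) e∈ rewrite squareEdges-𝟏 w with ∈-++⁻ (sqEdges (0 , 0)) e∈
  ... | inj₁ (here p) = here p
  ... | inj₁ (there (here refl)) = there (there (there (∈-map⁺ north (H00∈edgeList w))))
  ... | inj₁ (there (there (here p))) = there (here p)
  ... | inj₁ (there (there (there (here p)))) = there (there (here p))
  ... | inj₂ e∈′ with ∈-map⁻ north e∈′
  ...   | _ , e′∈ , refl = there (there (there (∈-map⁺ north (squareEdges⊆edgeList w e′∈))))

  vertexList⊆squareCorners : ∀ w {v} → v ∈ vertexList w → v ∈ squareCorners w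
  vertexList⊆squareCorners [] v∈ = v∈
  vertexList⊆squareCorners (𝟎 ∷ w) v∈ rewrite squareCorners-𝟎 w with v∈
  ... | here p = here p
  ... | there (here p) = there (there (here p))
  ... | there (there v∈′) with ∈-map⁻ eastᵖ v∈′
  ...   | _ , v′∈ , refl = ∈-++⁺ʳ (corners (0 , 0)) (∈-map⁺ eastᵖ (vertexList⊆squareCorners w v′∈))
  vertexList⊆squareCorners (𝟏 ∷ w) v∈ rewrite squareCorners-𝟏 w with v∈
  ... | here p = here p
  ... | there (here p) = there (here p)
  ... | there (there v∈′) with ∈-map⁻ northᵖ v∈′
  ...   | _ , v′∈ , refl = ∈-++⁺ʳ (corners (0 , 0)) (∈-map⁺ northᵖ (vertexList⊆squareCorners w v′∈))

  squareCorners⊆vertexList : ∀ w {v} → v ∈ squareCorners w → v ∈ vertexList w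
  squareCorners⊆vertexList [] v∈ = v∈
  squareCorners⊆vertexList (𝟎 ∷ w) v∈ rewrite squareCorners-𝟎 w with ∈-++⁻ (corners (0 , 0)) v∈
  ... | inj₁ (here p) = here p
  ... | inj₁ (there (here refl)) = there (there (∈-map⁺ eastᵖ (origin∈vertexList w)))
  ... | inj₁ (there (there (here p))) = there (here p)
  ... | inj₁ (there (there (there (here refl)))) = there (there (∈-map⁺ eastᵖ (01∈vertexList w)))
  ... | inj₂ v∈′ with ∈-map⁻ eastᵖ v∈′
  ...   | _ , v′∈ , refl = there (there (∈-map⁺ eastᵖ (squareCorners⊆vertexList w v′∈)))
  squareCorners⊆vertexList (𝟏 ∷ w) v∈ rewrite squareCorners-𝟏 w with ∈-++⁻ (corners (0 , 0)) v∈
  ... | inj₁ (here p) = here p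
  ... | inj₁ (there (here p)) = there (here p)
  ... | inj₁ (there (there (here refl))) = there (there (∈-map⁺ northᵖ (origin∈vertexList w)))
  ... | inj₁ (there (there (there (here refl)))) = there (there (∈-map⁺ northᵖ (10∈vertexList w)))
  ... | inj₂ v∈′ with ∈-map⁻ northᵖ v∈′
  ...   | _ , v′∈ , refl = there (there (∈-map⁺ northᵖ (squareCorners⊆vertexList w v′∈)))

  east-injective : ∀ {e e′} → east e ≡ east e′ → e ≡ e′
  east-injective {H _ _} {H _ _} refl = refl
  east-injective {V _ _} {V _ _} refl = refl

  north-injective : ∀ {e e′} → north e ≡ north e′ → e ≡ e′
  north-injective {H _ _} {H _ _} refl = refl
  north-injective {V _ _} {V _ _} refl = refl

  All-map-universal : ∀ {A : Set} {P : A → Set} (f : A → A) → (∀ a → P (f a)) → ∀ as → All P (map f as)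
  All-map-universal f Pf as = All.map⁺ (All.universal Pf as)

  edgeList-unique : ∀ w → Unique (edgeList w)
  edgeList-unique [] = ((λ ()) ∷ (λ ()) ∷ (λ ()) ∷ []) ∷ ((λ ()) ∷ (λ ()) ∷ []) ∷ ((λ ()) ∷ []) ∷ [] ∷ []
  edgeList-unique (𝟎 ∷ w) =
    ((λ ()) ∷ (λ ()) ∷ All-map-universal east (fresh (H 0 0) (λ ()) (λ ())) (edgeList w))
    ∷ ((λ ()) ∷ All-map-universal east (fresh (H 0 1) (λ ()) (λ ())) (edgeList w))
    ∷ All-map-universal east (fresh (V 0 0) (λ ()) (λ ())) (edgeList w) ∷ Unique.map⁺ east-injective (edgeList-unique w)
    where
    fresh : ∀ d → (∀ {x y} → d ≢ H (suc x) y) → (∀ {x y} → d ≢ V (suc x) y) → ∀ e → d ≢ east e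
    fresh d d≢H d≢V (H _ _) = d≢H
    fresh d d≢H d≢V (V _ _) = d≢V
  edgeList-unique (𝟏 ∷ w) =
    ((λ ()) ∷ (λ ()) ∷ All-map-universal north (fresh (H 0 0) (λ ()) (λ ())) (edgeList w))
    ∷ ((λ ()) ∷ All-map-universal north (fresh (V 0 0) (λ ()) (λ ())) (edgeList w))
    ∷ All-map-universal north (fresh (V 1 0) (λ ()) (λ ())) (edgeList w) ∷ Unique.map⁺ north-injective (edgeList-unique w)
    where
    fresh : ∀ d → (∀ {x y} → d ≢ H x (suc y)) → (∀ {x y} → d ≢ V x (suc y)) → ∀ e → d ≢ north e
    fresh d d≢H d≢V (H _ _) = d≢H
    fresh d d≢H d≢V (V _ _) = d≢V

  edgesG↭edgeList : ∀ w → edgesG w ↭ edgeList w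
  edgesG↭edgeList w = ∼bag⇒↭ (unique∧set⇒bag (deduplicate-! (squareEdges w)) (edgeList-unique w)
    (mk⇔ (squareEdges⊆edgeList w ∘ ∈-deduplicate⁻ _≟E_ (squareEdges w))
         (∈-deduplicate⁺ _≟E_ ∘ edgeList⊆squareEdges w)))

  module _ {A : Set} (P : A → Bool) where

    all-elim : ∀ {x} xs → x ∈ xs → all P xs ≡ true → P x ≡ true
    all-elim (y ∷ xs) (here refl) all≡ with P y
    ... | true = refl
    all-elim (y ∷ xs) (there x∈) all≡ with P y
    ... | true = all-elim xs x∈ all≡

    all-intro : ∀ xs → (∀ {x} → x ∈ xs → P x ≡ true) → all P xs ≡ true
    all-intro [] _ = refl
    all-intro (x ∷ xs) P∈ rewrite P∈ (here refl) = all-intro xs (P∈ ∘ there)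

    all-same-members : ∀ xs ys → (∀ {x} → x ∈ xs → x ∈ ys) → (∀ {x} → x ∈ ys → x ∈ xs) → all P xs ≡ all P ys
    all-same-members xs ys xs⊆ys ys⊆xs with all P xs in eq₁ | all P ys in eq₂
    ... | true | true = refl
    ... | false | false = refl
    ... | true | false = sym (trans (sym eq₂) (all-intro ys (λ x∈ → all-elim xs (ys⊆xs x∈) eq₁)))
    ... | false | true = trans (sym eq₁) (all-intro xs (λ x∈ → all-elim ys (xs⊆ys x∈) eq₂))

  all-map : ∀ {A : Set} (P : A → Bool) (f : A → A) xs → all P (map f xs) ≡ all (P ∘ f) xs
  all-map P f [] = refl
  all-map P f (x ∷ xs) = cong (P (f x) ∧_) (all-map P f xs)

  all-cong : ∀ {A : Set} {P Q : A → Bool} → (∀ x → P x ≡ Q x) → ∀ xs → all P xs ≡ all Q xs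
  all-cong P≗Q [] = refl
  all-cong P≗Q (x ∷ xs) = cong₂ _∧_ (P≗Q x) (all-cong P≗Q xs)

  all-vertsG≡all-vertexList : ∀ (P : Point → Bool) w → all P (vertsG w) ≡ all P (vertexList w)
  all-vertsG≡all-vertexList P w = all-same-members P (vertsG w) (vertexList w)
    (squareCorners⊆vertexList w ∘ ∈-deduplicate⁻ _≟P_ (squareCorners w))
    (∈-deduplicate⁺ _≟P_ ∘ vertexList⊆squareCorners w)

  ∈ᵇ⇒∈ : ∀ {e} S → e ∈ᵇ S ≡ true → e ∈ S
  ∈ᵇ⇒∈ {e} (x ∷ S) eq with e ≟E x
  ... | yes refl = here refl
  ... | no _ = there (∈ᵇ⇒∈ S eq)

  ∈⇒∈ᵇ : ∀ {e} S → e ∈ S → e ∈ᵇ S ≡ true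
  ∈⇒∈ᵇ {e} (x ∷ S) (here refl) with e ≟E e
  ... | yes _ = refl
  ... | no e≢e = ⊥-elim (e≢e refl)
  ∈⇒∈ᵇ {e} (x ∷ S) (there e∈) rewrite ∈⇒∈ᵇ S e∈ = ∨-zeroʳ ⌊ e ≟E x ⌋

  subsets⊆ : ∀ {A : Set} (L : List A) {S x} → S ∈ subsets L → x ∈ S → x ∈ L
  subsets⊆ [] (here refl) ()
  subsets⊆ (y ∷ L) S∈ x∈ with ∈-++⁻ (map (y ∷_) (subsets L)) S∈
  ... | inj₂ S∈′ = there (subsets⊆ L S∈′ x∈)
  ... | inj₁ S∈′ with ∈-map⁻ (y ∷_) S∈′ | x∈
  ...   | _ , _ , refl | here refl = here refl
  ...   | _ , S′∈ , refl | there x∈′ = there (subsets⊆ L S′∈ x∈′)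

  count-subset : ∀ L → Unique L → ∀ {S} → S ∈ subsets L → ∀ (p : Edge → Bool) →
    count p S ≡ count (λ e → e ∈ᵇ S ∧ p e) L
  count-subset [] [] (here refl) p = refl
  count-subset (x ∷ L) (x∉L ∷ uL) {S} S∈ p with ∈-++⁻ (map (x ∷_) (subsets L)) S∈
  ... | inj₂ S∈′ = trans (count-subset L uL S∈′ p) (cong (λ b → bit (b ∧ p x) + _) (sym x∉S))
    where
    x∉S : x ∈ᵇ S ≡ false
    x∉S with x ∈ᵇ S in eq
    ... | false = refl
    ... | true = ⊥-elim (All.lookup x∉L (subsets⊆ L S∈′ (∈ᵇ⇒∈ S eq)) refl)
  ... | inj₁ S∈′ with ∈-map⁻ (x ∷_) S∈′
  ...   | S′ , S′∈ , refl = cong₂ _+_ (cong (λ b → bit (b ∧ p x)) (sym (∈⇒∈ᵇ (x ∷ S′) (here refl))))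
          (trans (count-subset L uL S′∈ p) (count-congᴸ L (λ {e} e∈ → cong (λ b → (b ∨ e ∈ᵇ S′) ∧ p e) (sym (x≢ e∈)))))
    where
    x≢ : ∀ {e} → e ∈ L → ⌊ e ≟E x ⌋ ≡ false
    x≢ {e} e∈ with e ≟E x
    ... | yes refl = ⊥-elim (All.lookup x∉L e∈ refl)
    ... | no _ = refl

  -- Perfect matchings and area of edge sets

  -- Edge sets are characteristic functions, so that sums over all subsets of
  -- G(αw) can be split along the first square by recursion on the word.
  EdgeSet : Set
  EdgeSet = Edge → Bool

  insert : Edge → EdgeSet → EdgeSet
  insert x χ e = ⌊ e ≟E x ⌋ ∨ χ e

  insert-≡ : ∀ x χ e → insert x χ e ≡ (e ==ᴱ x) ∨ χ e
  insert-≡ x χ e = cong (_∨ χ e) (⌊≟E⌋≡==ᴱ e x)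

  touches : Point → Edge → Bool
  touches v (H x y) = (v ==ᴾ (x , y)) ∨ (v ==ᴾ (suc x , y))
  touches v (V x y) = (v ==ᴾ (x , y)) ∨ (v ==ᴾ (x , suc y))

  incident≡touches : ∀ v e → incident v e ≡ touches v e
  incident≡touches v (H x y) = cong₂ _∨_ (⌊≟P⌋≡==ᴾ v (x , y)) (⌊≟P⌋≡==ᴾ v (suc x , y))
  incident≡touches v (V x y) = cong₂ _∨_ (⌊≟P⌋≡==ᴾ v (x , y)) (⌊≟P⌋≡==ᴾ v (x , suc y))

  degree : List Edge → EdgeSet → Point → ℕ
  degree L μ v = count (λ e → μ e ∧ touches v e) L

  perfect : Word → EdgeSet → Bool
  perfect w μ = all (λ v → degree (edgeList w) μ v ≡ᵇ 1) (vertexList w)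

  perp : Word → EdgeSet → Bool
  perp w μ = if isEven (length w) then μ (H 0 0) else μ (V 0 0)

  crosses : ℕ → ℕ → Edge → Bool
  crosses a c (H _ _) = false
  crosses a c (V x y) = (y ≡ᵇ c) ∧ (a <ᵇ x)

  encloses : ℕ → ℕ → List Edge → EdgeSet → EdgeSet → Bool
  encloses a c L μ β = isOdd (count (λ e → (μ e xor β e) ∧ crosses a c e) L)

  sumBelow : ℕ → (ℕ → ℕ) → ℕ
  sumBelow zero f = 0
  sumBelow (suc n) f = f 0 + sumBelow n (f ∘ suc)

  areaOf : Word → EdgeSet → EdgeSet → ℕ
  areaOf w μ β = sumBelow N (λ a → sumBelow N (λ c → bit (encloses a c (edgeList w) μ β)))
    where
    N : ℕ
    N = suc (suc (length w))

  isPerfect≡perfect : ∀ w {m} → m ∈ subsets (edgesG w) → isPerfect w m ≡ perfect w (_∈ᵇ m)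
  isPerfect≡perfect w {m} m∈ =
    trans (all-vertsG≡all-vertexList _ w) (all-cong (λ v → cong (_≡ᵇ 1) (degree≡ v)) (vertexList w))
    where
    degree≡ : ∀ v → length (filterᵇ (incident v) m) ≡ degree (edgeList w) (_∈ᵇ m) v
    degree≡ v = begin
      length (filterᵇ (incident v) m)                    ≡⟨ length-filterᵇ (incident v) m ⟩
      count (incident v) m                               ≡⟨ count-cong (incident≡touches v) m ⟩
      count (touches v) m                                ≡⟨ count-subset (edgesG w) (deduplicate-! (squareEdges w)) m∈ (touches v) ⟩
      count (λ e → e ∈ᵇ m ∧ touches v e) (edgesG w)      ≡⟨ count-↭ _ (edgesG↭edgeList w) ⟩
      degree (edgeList w) (_∈ᵇ m) v                      ∎
      where open ≡-Reasoning

  sumBelow-cong : ∀ n {f g : ℕ → ℕ} → (∀ i → f i ≡ g i) → sumBelow n f ≡ sumBelow n g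
  sumBelow-cong zero f≗g = refl
  sumBelow-cong (suc n) f≗g = cong₂ _+_ (f≗g 0) (sumBelow-cong n (f≗g ∘ suc))

  sum-applyUpTo : ∀ n (g f : ℕ → ℕ) → sum (map f (applyUpTo g n)) ≡ sumBelow n (f ∘ g)
  sum-applyUpTo zero g f = refl
  sum-applyUpTo (suc n) g f = cong (f (g 0) +_) (sum-applyUpTo n (g ∘ suc) f)

  count-cartesianProduct : ∀ (p : Point → Bool) xs ys →
    count p (cartesianProductWith _,_ xs ys) ≡ sum (map (λ a → count (λ c → p (a , c)) ys) xs)
  count-cartesianProduct p [] ys = refl
  count-cartesianProduct p (x ∷ xs) ys =
    trans (count-++ p (map (x ,_) ys) _) (cong₂ _+_ (count-map (x ,_) p ys) (count-cartesianProduct p xs ys))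

  area≡areaOf : ∀ w m b → area w m b ≡ areaOf w (_∈ᵇ m) (_∈ᵇ b)
  area≡areaOf w m b = begin
    length (filterᵇ inside (cellsBox w))                          ≡⟨ length-filterᵇ inside (cellsBox w) ⟩
    count inside (cellsBox w)                                     ≡⟨ count-cartesianProduct inside (upTo N) (upTo N) ⟩
    sum (map (λ a → count (λ c → inside (a , c)) (upTo N)) (upTo N))
      ≡⟨ sum-applyUpTo N (λ i → i) (λ a → count (λ c → inside (a , c)) (upTo N)) ⟩
    sumBelow N (λ a → count (λ c → inside (a , c)) (upTo N))
      ≡⟨ sumBelow-cong N (λ a → sum-applyUpTo N (λ i → i) (λ c → bit (inside (a , c)))) ⟩
    sumBelow N (λ a → sumBelow N (λ c → bit (inside (a , c))))
      ≡⟨ sumBelow-cong N (λ a → sumBelow-cong N (λ c → cong bit (inside≡encloses a c))) ⟩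
    areaOf w (_∈ᵇ m) (_∈ᵇ b)                                      ∎
    where
    open ≡-Reasoning
    N : ℕ
    N = suc (suc (length w))
    D : List Edge
    D = symDiff w m b
    inside : Point → Bool
    inside p = not (isEven (crossings p D))
    crossings≡ : ∀ a c → crossings (a , c) D ≡ count (crosses a c) D
    crossings≡ a c = trans (length-filterᵇ _ D) (count-cong (λ { (H _ _) → refl ; (V _ _) → refl }) D)
    inside≡encloses : ∀ a c → inside (a , c) ≡ encloses a c (edgeList w) (_∈ᵇ m) (_∈ᵇ b)
    inside≡encloses a c = begin
      not (isEven (crossings (a , c) D))      ≡⟨ cong not (isEven≡not-isOdd (crossings (a , c) D)) ⟩
      not (not (isOdd (crossings (a , c) D))) ≡⟨ not-involutive _ ⟩
      isOdd (crossings (a , c) D)             ≡⟨ cong isOdd (trans (crossings≡ a c) (count-filterᵇ _ _ (edgesG w))) ⟩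
      isOdd (count (λ e → ((e ∈ᵇ m) xor (e ∈ᵇ b)) ∧ crosses a c e) (edgesG w))
                                              ≡⟨ cong isOdd (count-↭ _ (edgesG↭edgeList w)) ⟩
      encloses a c (edgeList w) (_∈ᵇ m) (_∈ᵇ b) ∎

  -- Splitting off the first square

  insert-self : ∀ x χ → insert x χ x ≡ true
  insert-self x χ with x ≟E x
  ... | yes _ = refl
  ... | no x≢x = ⊥-elim (x≢x refl)

  insert-other : ∀ {x e} χ → e ≢ x → insert x χ e ≡ χ e
  insert-other {x} {e} χ e≢x with e ≟E x
  ... | yes e≡x = ⊥-elim (e≢x e≡x)
  ... | no _ = refl

  count-insert : ∀ {x} L → Unique L → x ∈ L → ∀ {χ} → χ x ≡ false → ∀ (g : Edge → Bool) →
    count (λ e → insert x χ e ∧ g e) L ≡ bit (g x) + count (λ e → χ e ∧ g e) L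
  count-insert {x} (.x ∷ L) (x∉L ∷ _) (here refl) {χ} χx≡false g rewrite insert-self x χ | χx≡false =
    cong (bit (g x) +_) (count-congᴸ L (λ e∈ → cong (_∧ _) (insert-other χ (λ { refl → All.lookup x∉L e∈ refl }))))
  count-insert {x} (y ∷ L) (y∉L ∷ uL) (there x∈L) {χ} χx≡false g =
    trans (cong₂ _+_ (cong (λ b → bit (b ∧ g y)) (insert-other χ (λ { refl → All.lookup y∉L x∈L refl })))
                     (count-insert L uL x∈L χx≡false g))
          (+-leftComm (bit (χ y ∧ g y)) (bit (g x)) _)

  degree-east-column0 : ∀ L μ y → degree (map east L) μ (0 , y) ≡ 0
  degree-east-column0 L μ y = trans (count-map east _ L) (count-none none L)
    where
    none : ∀ e → (μ (east e) ∧ touches (0 , y) (east e)) ≡ false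
    none (H _ _) = ∧-zeroʳ _
    none (V _ _) = ∧-zeroʳ _

  degree-north-row0 : ∀ L μ x → degree (map north L) μ (x , 0) ≡ 0
  degree-north-row0 L μ x = trans (count-map north _ L) (count-none none L)
    where
    none : ∀ e → (μ (north e) ∧ touches (x , 0) (north e)) ≡ false
    none (H a _) rewrite ∧-zeroʳ (x ≡ᵇ a) | ∧-zeroʳ (x ≡ᵇ suc a) = ∧-zeroʳ _
    none (V a _) rewrite ∧-zeroʳ (x ≡ᵇ a) = ∧-zeroʳ _

  degree-east : ∀ L μ v → degree (map east L) μ (eastᵖ v) ≡ degree L (μ ∘ east) v
  degree-east L μ (a , b) = trans (count-map east _ L) (count-cong same L)
    where
    same : ∀ e → (μ (east e) ∧ touches (suc a , b) (east e)) ≡ (μ (east e) ∧ touches (a , b) e)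
    same (H _ _) = refl
    same (V _ _) = refl

  degree-north : ∀ L μ v → degree (map north L) μ (northᵖ v) ≡ degree L (μ ∘ north) v
  degree-north L μ (a , b) = trans (count-map north _ L) (count-cong same L)
    where
    same : ∀ e → (μ (north e) ∧ touches (a , suc b) (north e)) ≡ (μ (north e) ∧ touches (a , b) e)
    same (H _ _) = refl
    same (V _ _) = refl

  degree-origin : ∀ w μ → degree (edgeList w) μ (0 , 0) ≡ bit (μ (H 0 0)) + bit (μ (V 0 0))
  degree-origin [] μ
    rewrite ∧-identityʳ (μ (H 0 0)) | ∧-zeroʳ (μ (H 0 1)) | ∧-identityʳ (μ (V 0 0)) | ∧-zeroʳ (μ (V 1 0))
          | +-identityʳ (bit (μ (V 0 0))) = refl
  degree-origin (𝟎 ∷ w) μ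
    rewrite ∧-identityʳ (μ (H 0 0)) | ∧-zeroʳ (μ (H 0 1)) | ∧-identityʳ (μ (V 0 0))
          | degree-east-column0 (edgeList w) μ 0 | +-identityʳ (bit (μ (V 0 0))) = refl
  degree-origin (𝟏 ∷ w) μ
    rewrite ∧-identityʳ (μ (H 0 0)) | ∧-identityʳ (μ (V 0 0)) | ∧-zeroʳ (μ (V 1 0))
          | degree-north-row0 (edgeList w) μ 0 | +-identityʳ (bit (μ (V 0 0))) = refl

  perfect⇒origin : ∀ w μ → perfect w μ ≡ true → (bit (μ (H 0 0)) + bit (μ (V 0 0)) ≡ᵇ 1) ≡ true
  perfect⇒origin w μ perf =
    subst (λ d → (d ≡ᵇ 1) ≡ true) (degree-origin w μ) (all-elim _ (vertexList w) (origin∈vertexList w) perf)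

  perfect-𝟎 : ∀ w μ → perfect (𝟎 ∷ w) μ ≡
    ((bit (μ (H 0 0)) + bit (μ (V 0 0))) ≡ᵇ 1) ∧ (((bit (μ (H 0 1)) + bit (μ (V 0 0))) ≡ᵇ 1) ∧
    all (λ v → (bit (μ (H 0 0) ∧ (v ==ᴾ (0 , 0))) + (bit (μ (H 0 1) ∧ (v ==ᴾ (0 , 1)))
                + degree (edgeList w) (μ ∘ east) v)) ≡ᵇ 1) (vertexList w))
  perfect-𝟎 w μ = cong₂ _∧_ (cong (_≡ᵇ 1) (degree-origin (𝟎 ∷ w) μ)) (cong₂ _∧_ (cong (_≡ᵇ 1) degree01)
    (trans (all-map _ eastᵖ (vertexList w)) (all-cong (λ v → cong (_≡ᵇ 1) (degree-shifted v)) (vertexList w))))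
    where
    degree01 : degree (edgeList (𝟎 ∷ w)) μ (0 , 1) ≡ bit (μ (H 0 1)) + bit (μ (V 0 0))
    degree01 rewrite ∧-zeroʳ (μ (H 0 0)) | ∧-identityʳ (μ (H 0 1)) | ∧-identityʳ (μ (V 0 0))
                   | degree-east-column0 (edgeList w) μ 1 | +-identityʳ (bit (μ (V 0 0))) = refl
    degree-shifted : ∀ v → degree (edgeList (𝟎 ∷ w)) μ (eastᵖ v)
      ≡ bit (μ (H 0 0) ∧ (v ==ᴾ (0 , 0))) + (bit (μ (H 0 1) ∧ (v ==ᴾ (0 , 1))) + degree (edgeList w) (μ ∘ east) v)
    degree-shifted (a , b) rewrite ∧-zeroʳ (μ (V 0 0)) | degree-east (edgeList w) μ (a , b) = refl

  perfect-𝟏 : ∀ w μ → perfect (𝟏 ∷ w) μ ≡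
    ((bit (μ (H 0 0)) + bit (μ (V 0 0))) ≡ᵇ 1) ∧ (((bit (μ (H 0 0)) + bit (μ (V 1 0))) ≡ᵇ 1) ∧
    all (λ v → (bit (μ (V 0 0) ∧ (v ==ᴾ (0 , 0))) + (bit (μ (V 1 0) ∧ (v ==ᴾ (1 , 0)))
                + degree (edgeList w) (μ ∘ north) v)) ≡ᵇ 1) (vertexList w))
  perfect-𝟏 w μ = cong₂ _∧_ (cong (_≡ᵇ 1) (degree-origin (𝟏 ∷ w) μ)) (cong₂ _∧_ (cong (_≡ᵇ 1) degree10)
    (trans (all-map _ northᵖ (vertexList w)) (all-cong (λ v → cong (_≡ᵇ 1) (degree-shifted v)) (vertexList w))))
    where
    degree10 : degree (edgeList (𝟏 ∷ w)) μ (1 , 0) ≡ bit (μ (H 0 0)) + bit (μ (V 1 0))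
    degree10 rewrite ∧-identityʳ (μ (H 0 0)) | ∧-zeroʳ (μ (V 0 0)) | ∧-identityʳ (μ (V 1 0))
                   | degree-north-row0 (edgeList w) μ 1 | +-identityʳ (bit (μ (V 1 0))) = refl
    degree-shifted : ∀ v → degree (edgeList (𝟏 ∷ w)) μ (northᵖ v)
      ≡ bit (μ (V 0 0) ∧ (v ==ᴾ (0 , 0))) + (bit (μ (V 1 0) ∧ (v ==ᴾ (1 , 0))) + degree (edgeList w) (μ ∘ north) v)
    degree-shifted (a , b) rewrite ∧-zeroʳ (a ≡ᵇ 0) | ∧-zeroʳ (a ≡ᵇ 1) | ∧-zeroʳ (μ (H 0 0))
                                 | degree-north (edgeList w) μ (a , b) = refl

  perfect-insert-V00 : ∀ w ν → ν (V 0 0) ≡ false → perfect w (insert (V 0 0) ν)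
    ≡ all (λ v → (bit (v ==ᴾ (0 , 0)) + (bit (v ==ᴾ (0 , 1)) + degree (edgeList w) ν v)) ≡ᵇ 1) (vertexList w)
  perfect-insert-V00 w ν ν00≡false = all-cong (λ v → cong (_≡ᵇ 1) (begin
    degree (edgeList w) (insert (V 0 0) ν) v
      ≡⟨ count-insert (edgeList w) (edgeList-unique w) (V00∈edgeList w) ν00≡false (touches v) ⟩
    bit (touches v (V 0 0)) + degree (edgeList w) ν v
      ≡⟨ cong (_+ degree (edgeList w) ν v) (bit-touches v) ⟩
    (bit (v ==ᴾ (0 , 0)) + bit (v ==ᴾ (0 , 1))) + degree (edgeList w) ν v
      ≡⟨ +-assoc (bit (v ==ᴾ (0 , 0))) _ _ ⟩
    bit (v ==ᴾ (0 , 0)) + (bit (v ==ᴾ (0 , 1)) + degree (edgeList w) ν v) ∎)) (vertexList w)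
    where
    open ≡-Reasoning
    bit-touches : ∀ v → bit (touches v (V 0 0)) ≡ bit (v ==ᴾ (0 , 0)) + bit (v ==ᴾ (0 , 1))
    bit-touches (zero , zero) = refl
    bit-touches (zero , suc zero) = refl
    bit-touches (zero , suc (suc b)) = refl
    bit-touches (suc a , b) = refl

  perfect-insert-H00 : ∀ w ν → ν (H 0 0) ≡ false → perfect w (insert (H 0 0) ν)
    ≡ all (λ v → (bit (v ==ᴾ (0 , 0)) + (bit (v ==ᴾ (1 , 0)) + degree (edgeList w) ν v)) ≡ᵇ 1) (vertexList w)
  perfect-insert-H00 w ν ν00≡false = all-cong (λ v → cong (_≡ᵇ 1) (begin
    degree (edgeList w) (insert (H 0 0) ν) v
      ≡⟨ count-insert (edgeList w) (edgeList-unique w) (H00∈edgeList w) ν00≡false (touches v) ⟩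
    bit (touches v (H 0 0)) + degree (edgeList w) ν v
      ≡⟨ cong (_+ degree (edgeList w) ν v) (bit-touches v) ⟩
    (bit (v ==ᴾ (0 , 0)) + bit (v ==ᴾ (1 , 0))) + degree (edgeList w) ν v
      ≡⟨ +-assoc (bit (v ==ᴾ (0 , 0))) _ _ ⟩
    bit (v ==ᴾ (0 , 0)) + (bit (v ==ᴾ (1 , 0)) + degree (edgeList w) ν v) ∎)) (vertexList w)
    where
    open ≡-Reasoning
    bit-touches : ∀ v → bit (touches v (H 0 0)) ≡ bit (v ==ᴾ (0 , 0)) + bit (v ==ᴾ (1 , 0))
    bit-touches (zero , zero) = refl
    bit-touches (zero , suc b) = refl
    bit-touches (suc zero , zero) = refl
    bit-touches (suc zero , suc b) = refl
    bit-touches (suc (suc a) , b) = refl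

  exactly-one : ∀ a b → (bit a + bit b ≡ᵇ 1) ≡ true → b ≡ not a
  exactly-one true false _ = refl
  exactly-one false true _ = refl

  none-of-two : ∀ a b → (bit a + bit b ≡ᵇ 0) ≡ true → b ≡ false
  none-of-two false false _ = refl

  data Split𝟎 (w : Word) (μ : EdgeSet) : Set where
    vertical : μ (H 0 0) ≡ false → μ (H 0 1) ≡ false → μ (V 0 0) ≡ true →
      perfect w (μ ∘ east) ≡ true → Split𝟎 w μ
    horizontal : μ (H 0 0) ≡ true → μ (H 0 1) ≡ true → μ (V 0 0) ≡ false → μ (V 1 0) ≡ false →
      perfect w (insert (V 0 0) (μ ∘ east)) ≡ true → Split𝟎 w μ

  split𝟎 : ∀ w μ → perfect (𝟎 ∷ w) μ ≡ true → Split𝟎 w μ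
  split𝟎 w μ perf rewrite perfect-𝟎 w μ with μ (H 0 0) in h₀₀ | μ (H 0 1) in h₀₁ | μ (V 0 0) in v₀₀
  split𝟎 w μ perf | false | false | true = vertical h₀₀ h₀₁ v₀₀ perf
  split𝟎 w μ perf | true | true | false =
    horizontal h₀₀ h₀₁ v₀₀ μ10≡false (trans (perfect-insert-V00 w (μ ∘ east) μ10≡false) perf)
    where
    μ10≡false : μ (V 1 0) ≡ false
    μ10≡false = none-of-two (μ (H 1 0)) (μ (V 1 0))
      (subst (λ d → (d ≡ᵇ 0) ≡ true) (degree-origin w (μ ∘ east)) (all-elim _ (vertexList w) (origin∈vertexList w) perf))
  split𝟎 w μ () | true | true | true
  split𝟎 w μ () | true | false | true
  split𝟎 w μ () | true | false | false
  split𝟎 w μ () | false | true | true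
  split𝟎 w μ () | false | true | false
  split𝟎 w μ () | false | false | false

  data Split𝟏 (w : Word) (μ : EdgeSet) : Set where
    horizontal : μ (H 0 0) ≡ true → μ (V 0 0) ≡ false → μ (V 1 0) ≡ false →
      perfect w (μ ∘ north) ≡ true → Split𝟏 w μ
    vertical : μ (H 0 0) ≡ false → μ (V 0 0) ≡ true → μ (V 1 0) ≡ true → μ (H 0 1) ≡ false →
      perfect w (insert (H 0 0) (μ ∘ north)) ≡ true → Split𝟏 w μ

  split𝟏 : ∀ w μ → perfect (𝟏 ∷ w) μ ≡ true → Split𝟏 w μ
  split𝟏 w μ perf rewrite perfect-𝟏 w μ with μ (H 0 0) in h₀₀ | μ (V 0 0) in v₀₀ | μ (V 1 0) in v₁₀
  split𝟏 w μ perf | true | false | false = horizontal h₀₀ v₀₀ v₁₀ perf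
  split𝟏 w μ perf | false | true | true =
    vertical h₀₀ v₀₀ v₁₀ μ01≡false (trans (perfect-insert-H00 w (μ ∘ north) μ01≡false) perf)
    where
    μ01≡false : μ (H 0 1) ≡ false
    μ01≡false = none-of-two (μ (V 0 1)) (μ (H 0 1))
      (subst (λ d → (d ≡ᵇ 0) ≡ true) (trans (degree-origin w (μ ∘ north)) (+-comm (bit (μ (H 0 1))) (bit (μ (V 0 1)))))
             (all-elim _ (vertexList w) (origin∈vertexList w) perf))
  split𝟏 w μ () | true | true | true
  split𝟏 w μ () | true | true | false
  split𝟏 w μ () | true | false | true
  split𝟏 w μ () | false | true | false
  split𝟏 w μ () | false | false | true
  split𝟏 w μ () | false | false | false

  data Split[] (μ : EdgeSet) : Set where
    horizontal : μ (H 0 0) ≡ true → μ (H 0 1) ≡ true → μ (V 0 0) ≡ false → μ (V 1 0) ≡ false → Split[] μ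
    vertical : μ (H 0 0) ≡ false → μ (H 0 1) ≡ false → μ (V 0 0) ≡ true → μ (V 1 0) ≡ true → Split[] μ

  split[] : ∀ μ → perfect [] μ ≡ true → Split[] μ
  split[] μ perf with μ (H 0 0) in h₀₀ | μ (H 0 1) in h₀₁ | μ (V 0 0) in v₀₀ | μ (V 1 0) in v₁₀
  split[] μ perf | true | true | false | false = horizontal h₀₀ h₀₁ v₀₀ v₁₀
  split[] μ perf | false | false | true | true = vertical h₀₀ h₀₁ v₀₀ v₁₀
  split[] μ () | true | true | true | true
  split[] μ () | true | true | true | false
  split[] μ () | true | true | false | true
  split[] μ () | true | false | true | true
  split[] μ () | true | false | true | false
  split[] μ () | true | false | false | true
  split[] μ () | true | false | false | false
  split[] μ () | false | true | true | true
  split[] μ () | false | true | true | false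
  split[] μ () | false | true | false | true
  split[] μ () | false | true | false | false
  split[] μ () | false | false | true | false
  split[] μ () | false | false | false | true
  split[] μ () | false | false | false | false

  -- Row parity and the recursion for the area

  inRow : ℕ → Edge → Bool
  inRow c (H _ _) = false
  inRow c (V _ y) = y ≡ᵇ c

  rowParity : ℕ → List Edge → EdgeSet → Bool
  rowParity c L μ = isOdd (count (λ e → μ e ∧ inRow c e) L)

  -- The parity of the number of vertical edges in row c is the same for every
  -- perfect matching of G(w).
  rowParityOf : Word → ℕ → Bool
  rowParityOf [] c = false
  rowParityOf (𝟎 ∷ w) c = (0 ≡ᵇ c) xor rowParityOf w c
  rowParityOf (𝟏 ∷ w) zero = false
  rowParityOf (𝟏 ∷ w) (suc c) = rowParityOf w c

  rowParity-east : ∀ c L μ → rowParity c (map east L) μ ≡ rowParity c L (μ ∘ east)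
  rowParity-east c L μ = cong isOdd (trans (count-map east _ L) (count-cong same L))
    where
    same : ∀ e → (μ (east e) ∧ inRow c (east e)) ≡ (μ (east e) ∧ inRow c e)
    same (H _ _) = refl
    same (V _ _) = refl

  rowParity-north : ∀ c L μ → rowParity (suc c) (map north L) μ ≡ rowParity c L (μ ∘ north)
  rowParity-north c L μ = cong isOdd (trans (count-map north _ L) (count-cong same L))
    where
    same : ∀ e → (μ (north e) ∧ inRow (suc c) (north e)) ≡ (μ (north e) ∧ inRow c e)
    same (H _ _) = refl
    same (V _ _) = refl

  count-north-row0 : ∀ (L : List Edge) (μ : EdgeSet) → count (λ e → μ e ∧ inRow 0 e) (map north L) ≡ 0
  count-north-row0 L μ = trans (count-map north (λ e → μ e ∧ inRow 0 e) L) (count-none none L)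
    where
    none : ∀ e → (μ (north e) ∧ inRow 0 (north e)) ≡ false
    none (H _ _) = ∧-zeroʳ _
    none (V _ _) = ∧-zeroʳ _

  mutual
    perfect⇒rowParity : ∀ w μ → perfect w μ ≡ true → ∀ c → rowParity c (edgeList w) μ ≡ rowParityOf w c
    perfect⇒rowParity [] μ perf c with split[] μ perf
    ... | horizontal h₀₀ h₀₁ v₀₀ v₁₀ rewrite h₀₀ | h₀₁ | v₀₀ | v₁₀ = refl
    ... | vertical h₀₀ h₀₁ v₀₀ v₁₀ rewrite h₀₀ | h₀₁ | v₀₀ | v₁₀ = twice-even c
      where
      twice-even : ∀ c → isOdd (bit (0 ≡ᵇ c) + (bit (0 ≡ᵇ c) + 0)) ≡ false
      twice-even zero = refl
      twice-even (suc c) = refl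
    perfect⇒rowParity (𝟎 ∷ w) μ perf c = begin
      isOdd (bit (μ (H 0 0) ∧ false) + (bit (μ (H 0 1) ∧ false) + (bit (μ (V 0 0) ∧ z) + count row (map east L))))
        ≡⟨ cong₂ (λ a b → isOdd (bit a + (bit b + (bit (μ (V 0 0) ∧ z) + count row (map east L)))))
                 (∧-zeroʳ (μ (H 0 0))) (∧-zeroʳ (μ (H 0 1))) ⟩
      isOdd (bit (μ (V 0 0) ∧ z) + count row (map east L))
        ≡⟨ isOdd-bit+ (μ (V 0 0) ∧ z) _ ⟩
      (μ (V 0 0) ∧ z) xor rowParity c (map east L) μ
        ≡⟨ cong ((μ (V 0 0) ∧ z) xor_) (trans (rowParity-east c L μ) (rowParity-east-of-perfect w μ perf c)) ⟩
      (μ (V 0 0) ∧ z) xor ((z ∧ not (μ (V 0 0))) xor rowParityOf w c)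
        ≡⟨ cancel (μ (V 0 0)) z (rowParityOf w c) ⟩
      z xor rowParityOf w c ∎
      where
      open ≡-Reasoning
      z : Bool
      z = 0 ≡ᵇ c
      L : List Edge
      L = edgeList w
      row : Edge → Bool
      row e = μ e ∧ inRow c e
      cancel : ∀ m z r → (m ∧ z) xor ((z ∧ not m) xor r) ≡ z xor r
      cancel true true r = refl
      cancel true false r = refl
      cancel false true r = refl
      cancel false false r = refl
    perfect⇒rowParity (𝟏 ∷ w) μ perf zero =
      row0 (μ (H 0 0)) (μ (V 0 0)) (μ (V 1 0)) _ (count-north-row0 (edgeList w) μ) (both-sides (split𝟏 w μ perf))
      where
      both-sides : Split𝟏 w μ → μ (V 0 0) ≡ μ (V 1 0)
      both-sides (horizontal _ v₀₀ v₁₀ _) = trans v₀₀ (sym v₁₀)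
      both-sides (vertical _ v₀₀ v₁₀ _ _) = trans v₀₀ (sym v₁₀)
      row0 : ∀ h v v′ n → n ≡ 0 → v ≡ v′ → isOdd (bit (h ∧ false) + (bit (v ∧ true) + (bit (v′ ∧ true) + n))) ≡ false
      row0 h v .v .0 refl refl rewrite ∧-zeroʳ h | ∧-identityʳ v with v
      ... | true = refl
      ... | false = refl
    perfect⇒rowParity (𝟏 ∷ w) μ perf (suc c) =
      trans (skip-head (μ (H 0 0)) (μ (V 0 0)) (μ (V 1 0)) _) (trans (rowParity-north c (edgeList w) μ) (tail (split𝟏 w μ perf)))
      where
      skip-head : ∀ a b d n → isOdd (bit (a ∧ false) + (bit (b ∧ false) + (bit (d ∧ false) + n))) ≡ isOdd n
      skip-head a b d n rewrite ∧-zeroʳ a | ∧-zeroʳ b | ∧-zeroʳ d = refl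
      tail : Split𝟏 w μ → rowParity c (edgeList w) (μ ∘ north) ≡ rowParityOf w c
      tail (horizontal _ _ _ perf′) = perfect⇒rowParity w (μ ∘ north) perf′ c
      tail (vertical _ _ _ h₀₁ perf′) = begin
        rowParity c (edgeList w) (μ ∘ north)
          ≡⟨ cong isOdd (sym (count-insert (edgeList w) (edgeList-unique w) (H00∈edgeList w) h₀₁ (inRow c))) ⟩
        rowParity c (edgeList w) (insert (H 0 0) (μ ∘ north))
          ≡⟨ perfect⇒rowParity w _ perf′ c ⟩
        rowParityOf w c ∎
        where open ≡-Reasoning

    rowParity-east-of-perfect : ∀ w μ → perfect (𝟎 ∷ w) μ ≡ true → ∀ c →
      rowParity c (edgeList w) (μ ∘ east) ≡ ((0 ≡ᵇ c) ∧ not (μ (V 0 0))) xor rowParityOf w c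
    rowParity-east-of-perfect w μ perf c with split𝟎 w μ perf
    ... | vertical _ _ v₀₀ perf′ rewrite v₀₀ | ∧-zeroʳ (0 ≡ᵇ c) = perfect⇒rowParity w (μ ∘ east) perf′ c
    ... | horizontal _ _ v₀₀ v₁₀ perf′ rewrite v₀₀ | ∧-identityʳ (0 ≡ᵇ c) = begin
      rowParity c (edgeList w) (μ ∘ east)
        ≡⟨ sym (xor-cancel (0 ≡ᵇ c) _) ⟩
      (0 ≡ᵇ c) xor ((0 ≡ᵇ c) xor rowParity c (edgeList w) (μ ∘ east))
        ≡⟨ cong ((0 ≡ᵇ c) xor_) (sym (isOdd-bit+ (0 ≡ᵇ c) _)) ⟩
      (0 ≡ᵇ c) xor isOdd (bit (0 ≡ᵇ c) + count (λ e → μ (east e) ∧ inRow c e) (edgeList w))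
        ≡⟨ cong ((0 ≡ᵇ c) xor_) (cong isOdd (sym (count-insert (edgeList w) (edgeList-unique w) (V00∈edgeList w) v₁₀ (inRow c)))) ⟩
      (0 ≡ᵇ c) xor rowParity c (edgeList w) (insert (V 0 0) (μ ∘ east))
        ≡⟨ cong ((0 ≡ᵇ c) xor_) (perfect⇒rowParity w _ perf′ c) ⟩
      (0 ≡ᵇ c) xor rowParityOf w c ∎
      where
      open ≡-Reasoning
      xor-cancel : ∀ a b → a xor (a xor b) ≡ b
      xor-cancel true b = not-involutive b
      xor-cancel false b = refl

  InBox : ℕ → Edge → Set
  InBox n (H _ _) = ⊤
  InBox n (V x y) = x ≤ suc n × y ≤ n

  edgeList-inBox : ∀ w → All (InBox (length w)) (edgeList w)
  edgeList-inBox [] = tt ∷ tt ∷ (z≤n , z≤n) ∷ (s≤s z≤n , z≤n) ∷ []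
  edgeList-inBox (𝟎 ∷ w) = tt ∷ tt ∷ (z≤n , z≤n) ∷ All.map⁺ (All.map east-inBox (edgeList-inBox w))
    where
    east-inBox : ∀ {n e} → InBox n e → InBox (suc n) (east e)
    east-inBox {e = H _ _} _ = tt
    east-inBox {e = V _ _} (x≤ , y≤) = s≤s x≤ , m≤n⇒m≤1+n y≤
  edgeList-inBox (𝟏 ∷ w) = tt ∷ (z≤n , z≤n) ∷ (s≤s z≤n , z≤n) ∷ All.map⁺ (All.map north-inBox (edgeList-inBox w))
    where
    north-inBox : ∀ {n e} → InBox n e → InBox (suc n) (north e)
    north-inBox {e = H _ _} _ = tt
    north-inBox {e = V _ _} (x≤ , y≤) = m≤n⇒m≤1+n x≤ , s≤s y≤

  <⇒≡ᵇ≡false : ∀ {m n} → m < n → (m ≡ᵇ n) ≡ false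
  <⇒≡ᵇ≡false {zero} {suc n} _ = refl
  <⇒≡ᵇ≡false {suc m} {suc n} (s≤s m<n) = <⇒≡ᵇ≡false m<n

  ≤⇒<ᵇ≡false : ∀ {m n} → n ≤ m → (m <ᵇ n) ≡ false
  ≤⇒<ᵇ≡false {m} {zero} _ = refl
  ≤⇒<ᵇ≡false {suc m} {suc n} (s≤s n≤m) = ≤⇒<ᵇ≡false n≤m

  encloses-none : ∀ {a c L} μ β → All (λ e → crosses a c e ≡ false) L → encloses a c L μ β ≡ false
  encloses-none {a} {c} μ β none =
    cong isOdd (count-none′ none)
    where
    count-none′ : ∀ {L} → All (λ e → crosses a c e ≡ false) L → count (λ e → (μ e xor β e) ∧ crosses a c e) L ≡ 0
    count-none′ [] = refl
    count-none′ {e ∷ _} (e-none ∷ rest) rewrite e-none | ∧-zeroʳ (μ e xor β e) = count-none′ rest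

  encloses-above-box : ∀ w a μ β → encloses a (suc (suc (length w))) (edgeList w) μ β ≡ false
  encloses-above-box w a μ β = encloses-none μ β (All.map above (edgeList-inBox w))
    where
    above : ∀ {e} → InBox (length w) e → crosses a (suc (suc (length w))) e ≡ false
    above {H _ _} _ = refl
    above {V _ y} (_ , y≤) rewrite <⇒≡ᵇ≡false (s≤s (m≤n⇒m≤1+n y≤)) = refl

  encloses-right-of-box : ∀ w c μ β → encloses (suc (suc (length w))) c (edgeList w) μ β ≡ false
  encloses-right-of-box w c μ β = encloses-none μ β (All.map right (edgeList-inBox w))
    where
    right : ∀ {e} → InBox (length w) e → crosses (suc (suc (length w))) c e ≡ false
    right {H _ _} _ = refl
    right {V x y} (x≤ , _) rewrite ≤⇒<ᵇ≡false (m≤n⇒m≤1+n x≤) = ∧-zeroʳ (y ≡ᵇ c)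

  sumBelow-last : ∀ n f → sumBelow (suc n) f ≡ sumBelow n f + f n
  sumBelow-last zero f = +-comm (f 0) 0
  sumBelow-last (suc n) f = trans (cong (f 0 +_) (sumBelow-last n (f ∘ suc))) (sym (+-assoc (f 0) _ _))

  sumBelow-zero : ∀ n {f} → (∀ i → f i ≡ 0) → sumBelow n f ≡ 0
  sumBelow-zero zero f≗0 = refl
  sumBelow-zero (suc n) f≗0 rewrite f≗0 0 = sumBelow-zero n (f≗0 ∘ suc)

  sumBelow-+ : ∀ n f g → sumBelow n (λ i → f i + g i) ≡ sumBelow n f + sumBelow n g
  sumBelow-+ zero f g = refl
  sumBelow-+ (suc n) f g =
    trans (cong (f 0 + g 0 +_) (sumBelow-+ n (f ∘ suc) (g ∘ suc))) (+-interchange (f 0) (g 0) _ _)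

  sumBelow-drop-last : ∀ n f → f n ≡ 0 → sumBelow (suc n) f ≡ sumBelow n f
  sumBelow-drop-last n f fn≡0 = trans (sumBelow-last n f) (trans (cong (sumBelow n f +_) fn≡0) (+-identityʳ _))

  module _ (w : Word) (μ β : EdgeSet) where

    private
      L : List Edge
      L = edgeList w
      N : ℕ
      N = suc (suc (length w))

    encloses-column0-𝟎 : ∀ c →
      encloses 0 c (edgeList (𝟎 ∷ w)) μ β ≡ rowParity c L (λ e → μ (east e) xor β (east e))
    encloses-column0-𝟎 c
      rewrite ∧-zeroʳ (μ (H 0 0) xor β (H 0 0)) | ∧-zeroʳ (μ (H 0 1) xor β (H 0 1))
            | ∧-zeroʳ (0 ≡ᵇ c) | ∧-zeroʳ (μ (V 0 0) xor β (V 0 0)) =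
      cong isOdd (trans (count-map east _ L) (count-cong same L))
      where
      same : ∀ e → ((μ (east e) xor β (east e)) ∧ crosses 0 c (east e)) ≡ ((μ (east e) xor β (east e)) ∧ inRow c e)
      same (H _ _) = refl
      same (V x y) = cong ((μ (V (suc x) y) xor β (V (suc x) y)) ∧_) (∧-identityʳ (y ≡ᵇ c))

    encloses-east : ∀ a c → encloses (suc a) c (edgeList (𝟎 ∷ w)) μ β ≡ encloses a c L (μ ∘ east) (β ∘ east)
    encloses-east a c
      rewrite ∧-zeroʳ (μ (H 0 0) xor β (H 0 0)) | ∧-zeroʳ (μ (H 0 1) xor β (H 0 1))
            | ∧-zeroʳ (0 ≡ᵇ c) | ∧-zeroʳ (μ (V 0 0) xor β (V 0 0)) =
      cong isOdd (trans (count-map east _ L) (count-cong same L))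
      where
      same : ∀ e → ((μ (east e) xor β (east e)) ∧ crosses (suc a) c (east e)) ≡ ((μ (east e) xor β (east e)) ∧ crosses a c e)
      same (H _ _) = refl
      same (V _ _) = refl

    areaOf-𝟎-by-columns : areaOf (𝟎 ∷ w) μ β
      ≡ sumBelow (suc N) (λ c → bit (rowParity c L (λ e → μ (east e) xor β (east e)))) + areaOf w (μ ∘ east) (β ∘ east)
    areaOf-𝟎-by-columns = cong₂ _+_
      (sumBelow-cong (suc N) (cong bit ∘ encloses-column0-𝟎))
      (sumBelow-cong N (λ a → trans
        (sumBelow-drop-last N (λ c → bit (encloses (suc a) c (edgeList (𝟎 ∷ w)) μ β))
          (cong bit (trans (encloses-east a N) (encloses-above-box w a (μ ∘ east) (β ∘ east)))))
        (sumBelow-cong N (cong bit ∘ encloses-east a))))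

    encloses-north : ∀ a c → encloses a (suc c) (edgeList (𝟏 ∷ w)) μ β ≡ encloses a c L (μ ∘ north) (β ∘ north)
    encloses-north a c
      rewrite ∧-zeroʳ (μ (H 0 0) xor β (H 0 0)) | ∧-zeroʳ (μ (V 0 0) xor β (V 0 0))
            | ∧-zeroʳ (μ (V 1 0) xor β (V 1 0)) =
      cong isOdd (trans (count-map north _ L) (count-cong same L))
      where
      same : ∀ e → ((μ (north e) xor β (north e)) ∧ crosses a (suc c) (north e)) ≡ ((μ (north e) xor β (north e)) ∧ crosses a c e)
      same (H _ _) = refl
      same (V _ _) = refl

    encloses-row0-𝟏 : ∀ a → encloses a 0 (edgeList (𝟏 ∷ w)) μ β ≡ (μ (V 1 0) xor β (V 1 0)) ∧ (a <ᵇ 1)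
    encloses-row0-𝟏 a = trans (cong isOdd (begin
      count P (H 0 0 ∷ V 0 0 ∷ V 1 0 ∷ map north L)
        ≡⟨ cong₂ (λ x y → bit x + (bit y + count P (V 1 0 ∷ map north L)))
                 (∧-zeroʳ (μ (H 0 0) xor β (H 0 0))) (trans (cong ((μ (V 0 0) xor β (V 0 0)) ∧_) (<ᵇ-zero a)) (∧-zeroʳ _)) ⟩
      bit (P (V 1 0)) + count P (map north L)
        ≡⟨ cong (bit (P (V 1 0)) +_) (trans (count-map north P L) (count-none none L)) ⟩
      bit (P (V 1 0)) + 0 ∎)) (trans (isOdd-bit+ (P (V 1 0)) 0) (xor-identityʳ _))
      where
      open ≡-Reasoning
      P : Edge → Bool
      P e = (μ e xor β e) ∧ crosses a 0 e
      <ᵇ-zero : ∀ a → (a <ᵇ 0) ≡ false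
      <ᵇ-zero zero = refl
      <ᵇ-zero (suc a) = refl
      none : ∀ e → P (north e) ≡ false
      none (H _ _) = ∧-zeroʳ _
      none (V _ _) = ∧-zeroʳ _

    areaOf-𝟏 : areaOf (𝟏 ∷ w) μ β ≡ bit (μ (V 1 0) xor β (V 1 0)) + areaOf w (μ ∘ north) (β ∘ north)
    areaOf-𝟏 = begin
      sumBelow (suc N) (λ a → sumBelow (suc N) (λ c → cell a c))
        ≡⟨ sumBelow-+ (suc N) (λ a → cell a 0) (λ a → sumBelow N (λ c → cell a (suc c))) ⟩
      sumBelow (suc N) (λ a → cell a 0) + sumBelow (suc N) (λ a → sumBelow N (λ c → cell a (suc c)))
        ≡⟨ cong₂ _+_ row0 (sumBelow-drop-last N (λ a → sumBelow N (λ c → cell a (suc c))) (sumBelow-zero N (λ c → cong bit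
             (trans (encloses-north N c) (encloses-right-of-box w c (μ ∘ north) (β ∘ north)))))) ⟩
      bit (V10-differs) + sumBelow N (λ a → sumBelow N (λ c → cell a (suc c)))
        ≡⟨ cong (bit V10-differs +_) (sumBelow-cong N (λ a → sumBelow-cong N (λ c → cong bit (encloses-north a c)))) ⟩
      bit V10-differs + areaOf w (μ ∘ north) (β ∘ north) ∎
      where
      open ≡-Reasoning
      V10-differs : Bool
      V10-differs = μ (V 1 0) xor β (V 1 0)
      cell : ℕ → ℕ → ℕ
      cell a c = bit (encloses a c (edgeList (𝟏 ∷ w)) μ β)
      row0 : sumBelow (suc N) (λ a → cell a 0) ≡ bit V10-differs
      row0 = trans (cong₂ _+_ (cong bit (trans (encloses-row0-𝟏 0) (∧-identityʳ _)))
                              (sumBelow-zero N (λ a → cong bit (trans (encloses-row0-𝟏 (suc a)) (∧-zeroʳ _)))))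
                   (+-identityʳ _)

  rowParity-xor : ∀ c L μ β → rowParity c L (λ e → μ e xor β e) ≡ rowParity c L μ xor rowParity c L β
  rowParity-xor c L μ β =
    trans (cong isOdd (count-cong (λ e → ∧-distribʳ-xor (inRow c e) (μ e) (β e)) L))
          (isOdd-count-xor (λ e → μ e ∧ inRow c e) (λ e → β e ∧ inRow c e) L)

  areaOf-𝟎 : ∀ w μ β → perfect (𝟎 ∷ w) μ ≡ true → perfect (𝟎 ∷ w) β ≡ true →
    areaOf (𝟎 ∷ w) μ β ≡ bit (μ (V 0 0) xor β (V 0 0)) + areaOf w (μ ∘ east) (β ∘ east)
  areaOf-𝟎 w μ β perfμ perfβ = trans (areaOf-𝟎-by-columns w μ β) (cong (_+ areaOf w (μ ∘ east) (β ∘ east)) (begin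
    sumBelow (suc N) (λ c → bit (rowParity c (edgeList w) (λ e → μ (east e) xor β (east e))))
      ≡⟨ sumBelow-cong (suc N) (cong bit ∘ column0) ⟩
    bit (μ (V 0 0) xor β (V 0 0)) + sumBelow N (λ _ → 0)
      ≡⟨ cong (_ +_) (sumBelow-zero N (λ _ → refl)) ⟩
    bit (μ (V 0 0) xor β (V 0 0)) + 0
      ≡⟨ +-identityʳ _ ⟩
    bit (μ (V 0 0) xor β (V 0 0)) ∎))
    where
    open ≡-Reasoning
    N : ℕ
    N = suc (suc (length w))
    parities-differ : ∀ z m b r → ((z ∧ not m) xor r) xor ((z ∧ not b) xor r) ≡ z ∧ (m xor b)
    parities-differ true true true r = xor-same r
    parities-differ true true false r = xor-inverseʳ r
    parities-differ true false true r = xor-inverseˡ r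
    parities-differ true false false r = xor-same (not r)
    parities-differ false m b r = xor-same r
    column0 : ∀ c → rowParity c (edgeList w) (λ e → μ (east e) xor β (east e)) ≡ (0 ≡ᵇ c) ∧ (μ (V 0 0) xor β (V 0 0))
    column0 c = begin
      rowParity c (edgeList w) (λ e → μ (east e) xor β (east e))
        ≡⟨ rowParity-xor c (edgeList w) (μ ∘ east) (β ∘ east) ⟩
      rowParity c (edgeList w) (μ ∘ east) xor rowParity c (edgeList w) (β ∘ east)
        ≡⟨ cong₂ _xor_ (rowParity-east-of-perfect w μ perfμ c) (rowParity-east-of-perfect w β perfβ c) ⟩
      (((0 ≡ᵇ c) ∧ not (μ (V 0 0))) xor rowParityOf w c) xor (((0 ≡ᵇ c) ∧ not (β (V 0 0))) xor rowParityOf w c)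
        ≡⟨ parities-differ (0 ≡ᵇ c) (μ (V 0 0)) (β (V 0 0)) (rowParityOf w c) ⟩
      (0 ≡ᵇ c) ∧ (μ (V 0 0) xor β (V 0 0)) ∎

  -- Rays start at cell centres with nonnegative abscissa, so they only cross
  -- vertical edges V x y with x ≥ 1.
  areaOf-cong : ∀ w {μ μ′ β β′ : EdgeSet} →
    (∀ x y → μ (V (suc x) y) ≡ μ′ (V (suc x) y)) → (∀ x y → β (V (suc x) y) ≡ β′ (V (suc x) y)) →
    areaOf w μ β ≡ areaOf w μ′ β′
  areaOf-cong w {μ} {μ′} {β} {β′} μ≗μ′ β≗β′ = sumBelow-cong N (λ a → sumBelow-cong N (λ c →
    cong bit (cong isOdd (count-cong (same a c) (edgeList w)))))
    where
    N : ℕ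
    N = suc (suc (length w))
    same : ∀ a c e → ((μ e xor β e) ∧ crosses a c e) ≡ ((μ′ e xor β′ e) ∧ crosses a c e)
    same a c (H _ _) = trans (∧-zeroʳ _) (sym (∧-zeroʳ _))
    same a c (V zero y) rewrite ∧-zeroʳ (y ≡ᵇ c) = trans (∧-zeroʳ _) (sym (∧-zeroʳ _))
    same a c (V (suc x) y) = cong₂ (λ m b → (m xor b) ∧ crosses a c (V (suc x) y)) (μ≗μ′ x y) (β≗β′ x y)

  -- The basic matching

  lastEdge : Word → Edge
  lastEdge w = V (suc (count0 w)) (count1 w)

  -- The edges shared by two consecutive squares: a matching using only boundary
  -- edges avoids them, and that is all that is used of the boundary condition.
  Interior : Word → Edge → Set
  Interior [] e = ⊥
  Interior (𝟎 ∷ w) e = e ≡ V 1 0 ⊎ Σ[ e′ ∈ Edge ] e ≡ east e′ × Interior w e′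
  Interior (𝟏 ∷ w) e = e ≡ H 0 1 ⊎ Σ[ e′ ∈ Edge ] e ≡ north e′ × Interior w e′

  record Basic (w : Word) (β : EdgeSet) : Set where
    field
      perfect-basic : perfect w β ≡ true
      avoids-interior : ∀ {e} → Interior w e → β e ≡ false
      contains-last : β (lastEdge w) ≡ true
  open Basic public

  squaresContaining : Word → Edge → ℕ
  squaresContaining w e = count (λ s → e ∈ᵇ sqEdges s) (squares w)

  ==ᴱ-east : ∀ e x → (east e ==ᴱ east x) ≡ (e ==ᴱ x)
  ==ᴱ-east (H _ _) (H _ _) = refl
  ==ᴱ-east (H _ _) (V _ _) = refl
  ==ᴱ-east (V _ _) (H _ _) = refl
  ==ᴱ-east (V _ _) (V _ _) = refl

  ==ᴱ-north : ∀ e x → (north e ==ᴱ north x) ≡ (e ==ᴱ x)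
  ==ᴱ-north (H _ _) (H _ _) = refl
  ==ᴱ-north (H _ _) (V _ _) = refl
  ==ᴱ-north (V _ _) (H _ _) = refl
  ==ᴱ-north (V _ _) (V _ _) = refl

  ∈ᵇ-map-shift : ∀ {s : Edge → Edge} → (∀ e x → (s e ==ᴱ s x) ≡ (e ==ᴱ x)) → ∀ e L → s e ∈ᵇ map s L ≡ e ∈ᵇ L
  ∈ᵇ-map-shift s-inj e [] = refl
  ∈ᵇ-map-shift {s} s-inj e (x ∷ L) =
    cong₂ _∨_ (trans (⌊≟E⌋≡==ᴱ (s e) (s x)) (trans (s-inj e x) (sym (⌊≟E⌋≡==ᴱ e x)))) (∈ᵇ-map-shift s-inj e L)

  squaresContaining-east : ∀ w e → squaresContaining (𝟎 ∷ w) (east e) ≡ bit (east e ∈ᵇ sqEdges (0 , 0)) + squaresContaining w e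
  squaresContaining-east w e = cong (_ +_) (trans (count-map _ _ (squares w))
    (count-cong (λ { (a , b) → ∈ᵇ-map-shift {east} ==ᴱ-east e (sqEdges (a , b)) }) (squares w)))

  squaresContaining-north : ∀ w e → squaresContaining (𝟏 ∷ w) (north e) ≡ bit (north e ∈ᵇ sqEdges (0 , 0)) + squaresContaining w e
  squaresContaining-north w e = cong (_ +_) (trans (count-map _ _ (squares w))
    (count-cong (λ { (a , b) → ∈ᵇ-map-shift {north} ==ᴱ-north e (sqEdges (a , b)) }) (squares w)))

  interior⇒two-squares : ∀ w {e} → Interior w e → 2 ≤ squaresContaining w e
  interior⇒two-squares (𝟎 ∷ []) (inj₁ refl) = s≤s (s≤s z≤n)
  interior⇒two-squares (𝟎 ∷ 𝟎 ∷ w) (inj₁ refl) = s≤s (s≤s z≤n)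
  interior⇒two-squares (𝟎 ∷ 𝟏 ∷ w) (inj₁ refl) = s≤s (s≤s z≤n)
  interior⇒two-squares (𝟎 ∷ w) (inj₂ (e , refl , int)) =
    ≤-trans (interior⇒two-squares w int) (≤-trans (m≤n+m _ _) (≤-reflexive (sym (squaresContaining-east w e))))
  interior⇒two-squares (𝟏 ∷ []) (inj₁ refl) = s≤s (s≤s z≤n)
  interior⇒two-squares (𝟏 ∷ 𝟎 ∷ w) (inj₁ refl) = s≤s (s≤s z≤n)
  interior⇒two-squares (𝟏 ∷ 𝟏 ∷ w) (inj₁ refl) = s≤s (s≤s z≤n)
  interior⇒two-squares (𝟏 ∷ w) (inj₂ (e , refl , int)) =
    ≤-trans (interior⇒two-squares w int) (≤-trans (m≤n+m _ _) (≤-reflexive (sym (squaresContaining-north w e))))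

  interior⇒not-boundary : ∀ w {e} → Interior w e → isBoundary w e ≡ false
  interior⇒not-boundary w {e} int = trans (cong (_≡ᵇ 1) (length-filterᵇ _ (squares w))) (≥2 (interior⇒two-squares w int))
    where
    ≥2 : ∀ {n} → 2 ≤ n → (n ≡ᵇ 1) ≡ false
    ≥2 (s≤s (s≤s _)) = refl

  isBasicMatching⇒Basic : ∀ w b → IsBasicMatching w b → Basic w (_∈ᵇ b)
  isBasicMatching⇒Basic w b bm = record
    { perfect-basic = trans (sym (isPerfect≡perfect w (proj₁ b∈))) (Equivalence.to T-≡ (proj₂ b∈))
    ; avoids-interior = avoids
    ; contains-last = ∈⇒∈ᵇ b (IsBasicMatching.lastVert bm)
    }
    where
    b∈ : b ∈ subsets (edgesG w) × T (isPerfect w b)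
    b∈ = ∈-filter⁻ (λ m → T? (isPerfect w m)) {xs = subsets (edgesG w)} (IsBasicMatching.perfect bm)
    avoids : ∀ {e} → Interior w e → e ∈ᵇ b ≡ false
    avoids {e} int with e ∈ᵇ b in e∈b
    ... | false = refl
    ... | true = ⊥-elim (subst T (interior⇒not-boundary w int) (All.lookup (IsBasicMatching.boundary bm) (∈ᵇ⇒∈ b e∈b)))

  interior≢V00 : ∀ w {e} → Interior w e → e ≢ V 0 0
  interior≢V00 (𝟎 ∷ w) (inj₁ refl) ()
  interior≢V00 (𝟎 ∷ w) (inj₂ (H _ _ , refl , _)) ()
  interior≢V00 (𝟎 ∷ w) (inj₂ (V _ _ , refl , _)) ()
  interior≢V00 (𝟏 ∷ w) (inj₁ refl) ()
  interior≢V00 (𝟏 ∷ w) (inj₂ (H _ _ , refl , _)) ()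
  interior≢V00 (𝟏 ∷ w) (inj₂ (V _ _ , refl , _)) ()

  interior≢H00 : ∀ w {e} → Interior w e → e ≢ H 0 0
  interior≢H00 (𝟎 ∷ w) (inj₁ refl) ()
  interior≢H00 (𝟎 ∷ w) (inj₂ (H _ _ , refl , _)) ()
  interior≢H00 (𝟎 ∷ w) (inj₂ (V _ _ , refl , _)) ()
  interior≢H00 (𝟏 ∷ w) (inj₁ refl) ()
  interior≢H00 (𝟏 ∷ w) (inj₂ (H _ _ , refl , _)) ()
  interior≢H00 (𝟏 ∷ w) (inj₂ (V _ _ , refl , _)) ()

  data BasicSplit𝟎 (w : Word) (β : EdgeSet) : Set where
    vertical : β (V 0 0) ≡ true → Basic w (β ∘ east) → BasicSplit𝟎 w β
    horizontal : β (V 0 0) ≡ false → Basic w (insert (V 0 0) (β ∘ east)) → BasicSplit𝟎 w β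

  basic-split𝟎 : ∀ {w β} → Basic (𝟎 ∷ w) β → BasicSplit𝟎 w β
  basic-split𝟎 {w} {β} bβ with split𝟎 w β (perfect-basic bβ)
  ... | vertical _ _ v₀₀ perf = vertical v₀₀ record
    { perfect-basic = perf
    ; avoids-interior = λ int → avoids-interior bβ (inj₂ (_ , refl , int))
    ; contains-last = contains-last bβ
    }
  ... | horizontal _ _ v₀₀ _ perf = horizontal v₀₀ record
    { perfect-basic = perf
    ; avoids-interior = λ int → trans (insert-other (β ∘ east) (interior≢V00 w int)) (avoids-interior bβ (inj₂ (_ , refl , int)))
    ; contains-last = trans (insert-other {V 0 0} (β ∘ east) (λ ())) (contains-last bβ)
    }

  data BasicSplit𝟏 (w : Word) (β : EdgeSet) : Set where
    horizontal : β (V 0 0) ≡ false → Basic w (β ∘ north) → BasicSplit𝟏 w β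
    vertical : β (V 0 0) ≡ true → Basic w (insert (H 0 0) (β ∘ north)) → BasicSplit𝟏 w β

  basic-split𝟏 : ∀ {w β} → Basic (𝟏 ∷ w) β → BasicSplit𝟏 w β
  basic-split𝟏 {w} {β} bβ with split𝟏 w β (perfect-basic bβ)
  ... | horizontal _ v₀₀ _ perf = horizontal v₀₀ record
    { perfect-basic = perf
    ; avoids-interior = λ int → avoids-interior bβ (inj₂ (_ , refl , int))
    ; contains-last = contains-last bβ
    }
  ... | vertical _ v₀₀ _ _ perf = vertical v₀₀ record
    { perfect-basic = perf
    ; avoids-interior = λ int → trans (insert-other (β ∘ north) (interior≢H00 w int)) (avoids-interior bβ (inj₂ (_ , refl , int)))
    ; contains-last = trans (insert-other {H 0 0} (β ∘ north) (λ ())) (contains-last bβ)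
    }

  basic-V00 : ∀ w {β} → Basic w β → β (V 0 0) ≡ isEven (length w)
  basic-V00 [] {β} bβ with split[] β (perfect-basic bβ)
  ... | horizontal _ _ _ v₁₀ with () ← trans (sym v₁₀) (contains-last bβ)
  ... | vertical _ _ v₀₀ _ = v₀₀
  basic-V00 (𝟎 ∷ w) {β} bβ with basic-split𝟎 bβ
  ... | vertical v₀₀ bβ′ = begin
    β (V 0 0)                ≡⟨ v₀₀ ⟩
    true                     ≡⟨ cong not (avoids-interior bβ (inj₁ refl)) ⟨
    not (β (V 1 0))          ≡⟨ cong not (basic-V00 w bβ′) ⟩
    not (isEven (length w))  ≡⟨ isEven-suc (length w) ⟨
    isEven (suc (length w))  ∎
    where open ≡-Reasoning
  ... | horizontal v₀₀ bβ′ = begin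
    β (V 0 0)                                       ≡⟨ v₀₀ ⟩
    false                                           ≡⟨ cong not (insert-self (V 0 0) (β ∘ east)) ⟨
    not (insert (V 0 0) (β ∘ east) (V 0 0))         ≡⟨ cong not (basic-V00 w bβ′) ⟩
    not (isEven (length w))                         ≡⟨ isEven-suc (length w) ⟨
    isEven (suc (length w))                         ∎
    where open ≡-Reasoning
  basic-V00 (𝟏 ∷ w) {β} bβ with basic-split𝟏 bβ
  ... | horizontal v₀₀ bβ′ = begin
    β (V 0 0)                ≡⟨ v₀₀ ⟩
    false                    ≡⟨ cong not V01∈β ⟨
    not (β (V 0 1))          ≡⟨ cong not (basic-V00 w bβ′) ⟩
    not (isEven (length w))  ≡⟨ isEven-suc (length w) ⟨
    isEven (suc (length w))  ∎
    where
    open ≡-Reasoning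
    V01∈β : β (V 0 1) ≡ true
    V01∈β = trans (exactly-one (β (H 0 1)) (β (V 0 1)) (perfect⇒origin w (β ∘ north) (perfect-basic bβ′)))
                  (cong not (avoids-interior bβ (inj₁ refl)))
  ... | vertical v₀₀ bβ′ = begin
    β (V 0 0)                ≡⟨ v₀₀ ⟩
    true                     ≡⟨ cong not V01∉β ⟨
    not (β (V 0 1))          ≡⟨ cong not (basic-V00 w bβ′) ⟩
    not (isEven (length w))  ≡⟨ isEven-suc (length w) ⟨
    isEven (suc (length w))  ∎
    where
    open ≡-Reasoning
    β′ : EdgeSet
    β′ = insert (H 0 0) (β ∘ north)
    V01∉β : β (V 0 1) ≡ false
    V01∉β = trans (exactly-one (β′ (H 0 0)) (β′ (V 0 0)) (perfect⇒origin w β′ (perfect-basic bβ′)))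
                  (cong not (insert-self (H 0 0) (β ∘ north)))

  basic-V10-𝟏 : ∀ w {β} → Basic (𝟏 ∷ w) β → β (V 1 0) ≡ isEven (length (𝟏 ∷ w))
  basic-V10-𝟏 w {β} bβ = trans (same-column (split𝟏 w β (perfect-basic bβ))) (basic-V00 (𝟏 ∷ w) bβ)
    where
    same-column : Split𝟏 w β → β (V 1 0) ≡ β (V 0 0)
    same-column (horizontal _ v₀₀ v₁₀ _) = trans v₁₀ (sym v₀₀)
    same-column (vertical _ v₀₀ v₁₀ _ _) = trans v₁₀ (sym v₀₀)

  basic-tail-𝟎 : ∀ {w β} → Basic (𝟎 ∷ w) β →
    Σ[ β′ ∈ EdgeSet ] Basic w β′ × (∀ x y → β (V (suc (suc x)) y) ≡ β′ (V (suc x) y))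
  basic-tail-𝟎 {β = β} bβ with basic-split𝟎 bβ
  ... | vertical _ bβ′ = _ , bβ′ , λ _ _ → refl
  ... | horizontal _ bβ′ = _ , bβ′ , λ _ _ → sym (insert-other {V 0 0} (β ∘ east) (λ ()))

  basic-tail-𝟏 : ∀ {w β} → Basic (𝟏 ∷ w) β →
    Σ[ β′ ∈ EdgeSet ] Basic w β′ × (∀ x y → β (V x (suc y)) ≡ β′ (V x y))
  basic-tail-𝟏 {β = β} bβ with basic-split𝟏 bβ
  ... | horizontal _ bβ′ = _ , bβ′ , λ _ _ → refl
  ... | vertical _ bβ′ = _ , bβ′ , λ _ _ → sym (insert-other {H 0 0} (β ∘ north) (λ ()))

  prepend𝟎 : Bool → Bool → Bool → EdgeSet → EdgeSet
  prepend𝟎 h₀₀ h₀₁ v₀₀ χ (H zero zero) = h₀₀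
  prepend𝟎 h₀₀ h₀₁ v₀₀ χ (H zero (suc zero)) = h₀₁
  prepend𝟎 h₀₀ h₀₁ v₀₀ χ (H zero (suc (suc y))) = false
  prepend𝟎 h₀₀ h₀₁ v₀₀ χ (H (suc x) y) = χ (H x y)
  prepend𝟎 h₀₀ h₀₁ v₀₀ χ (V zero zero) = v₀₀
  prepend𝟎 h₀₀ h₀₁ v₀₀ χ (V zero (suc y)) = false
  prepend𝟎 h₀₀ h₀₁ v₀₀ χ (V (suc x) y) = χ (V x y)

  prepend𝟏 : Bool → Bool → Bool → EdgeSet → EdgeSet
  prepend𝟏 h₀₀ v₀₀ v₁₀ χ (H x (suc y)) = χ (H x y)
  prepend𝟏 h₀₀ v₀₀ v₁₀ χ (H zero zero) = h₀₀
  prepend𝟏 h₀₀ v₀₀ v₁₀ χ (H (suc x) zero) = false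
  prepend𝟏 h₀₀ v₀₀ v₁₀ χ (V x (suc y)) = χ (V x y)
  prepend𝟏 h₀₀ v₀₀ v₁₀ χ (V zero zero) = v₀₀
  prepend𝟏 h₀₀ v₀₀ v₁₀ χ (V (suc zero) zero) = v₁₀
  prepend𝟏 h₀₀ v₀₀ v₁₀ χ (V (suc (suc x)) zero) = false

  prepend𝟎-east : ∀ h₀₀ h₀₁ v₀₀ χ e → prepend𝟎 h₀₀ h₀₁ v₀₀ χ (east e) ≡ χ e
  prepend𝟎-east _ _ _ _ (H _ _) = refl
  prepend𝟎-east _ _ _ _ (V _ _) = refl

  prepend𝟏-north : ∀ h₀₀ v₀₀ v₁₀ χ e → prepend𝟏 h₀₀ v₀₀ v₁₀ χ (north e) ≡ χ e
  prepend𝟏-north _ _ _ _ (H _ _) = refl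
  prepend𝟏-north _ _ _ _ (V _ _) = refl

  perfect-cong : ∀ w {μ μ′ : EdgeSet} → (∀ e → μ e ≡ μ′ e) → perfect w μ ≡ perfect w μ′
  perfect-cong w μ≗μ′ =
    all-cong (λ v → cong (_≡ᵇ 1) (count-cong (λ e → cong (_∧ touches v e) (μ≗μ′ e)) (edgeList w))) (vertexList w)

  perp-cong : ∀ w {μ μ′ : EdgeSet} → (∀ e → μ e ≡ μ′ e) → perp w μ ≡ perp w μ′
  perp-cong w μ≗μ′ = cong₂ (λ a b → if isEven (length w) then a else b) (μ≗μ′ (H 0 0)) (μ≗μ′ (V 0 0))

  perp-with-V00 : ∀ w μ → perfect w μ ≡ true → μ (V 0 0) ≡ true → perp w μ ≡ not (isEven (length w))
  perp-with-V00 w μ perf v₀₀ with isEven (length w)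
  ... | true = trans (sym (not-involutive _)) (cong not (trans (sym (exactly-one (μ (H 0 0)) _ (perfect⇒origin w μ perf))) v₀₀))
  ... | false = v₀₀

  perp-without-V00 : ∀ w μ → perfect w μ ≡ true → μ (V 0 0) ≡ false → perp w μ ≡ isEven (length w)
  perp-without-V00 w μ perf v₀₀ with isEven (length w)
  ... | true = trans (sym (not-involutive _)) (cong not (trans (sym (exactly-one (μ (H 0 0)) _ (perfect⇒origin w μ perf))) v₀₀))
  ... | false = v₀₀

  module _ (w : Word) where

    private
      n : ℕ
      n = length w

    perfect-vertical𝟎 : ∀ χ → perfect (𝟎 ∷ w) (prepend𝟎 false false true χ) ≡ perfect w χ
    perfect-vertical𝟎 χ = trans (perfect-𝟎 w (prepend𝟎 false false true χ)) (perfect-cong w (prepend𝟎-east false false true χ))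

    perfect-horizontal𝟎 : ∀ χ → χ (V 0 0) ≡ false →
      perfect (𝟎 ∷ w) (prepend𝟎 true true false χ) ≡ perfect w (insert (V 0 0) χ)
    perfect-horizontal𝟎 χ χ₀₀ = trans (perfect-𝟎 w (prepend𝟎 true true false χ)) (trans
      (all-cong (λ v → cong (λ d → (bit (v ==ᴾ (0 , 0)) + (bit (v ==ᴾ (0 , 1)) + d)) ≡ᵇ 1)
        (count-cong (λ e → cong (_∧ touches v e) (prepend𝟎-east true true false χ e)) (edgeList w))) (vertexList w))
      (sym (perfect-insert-V00 w χ χ₀₀)))

    perfect-horizontal𝟎-V00 : ∀ χ → perfect (𝟎 ∷ w) (prepend𝟎 true true false (insert (V 0 0) χ)) ≡ false
    perfect-horizontal𝟎-V00 χ with perfect (𝟎 ∷ w) (prepend𝟎 true true false (insert (V 0 0) χ)) in perf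
    ... | false = refl
    ... | true with split𝟎 w (prepend𝟎 true true false (insert (V 0 0) χ)) perf
    ...   | vertical () _ _ _
    ...   | horizontal _ _ _ v₁₀ _ with () ← trans (sym v₁₀) (insert-self (V 0 0) χ)

    perp-vertical𝟎 : ∀ χ → perp (𝟎 ∷ w) (prepend𝟎 false false true χ) ≡ isEven n
    perp-vertical𝟎 χ rewrite isEven-suc n with isEven n
    ... | true = refl
    ... | false = refl

    perp-horizontal𝟎 : ∀ χ → perp (𝟎 ∷ w) (prepend𝟎 true true false χ) ≡ not (isEven n)
    perp-horizontal𝟎 χ rewrite isEven-suc n with isEven n
    ... | true = refl
    ... | false = refl

    module _ {β β′ : EdgeSet} (perfβ : perfect (𝟎 ∷ w) β ≡ true)
             (β≗β′ : ∀ x y → β (V (suc (suc x)) y) ≡ β′ (V (suc x) y)) where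

      areaOf-vertical𝟎 : ∀ χ → perfect w χ ≡ true →
        areaOf (𝟎 ∷ w) (prepend𝟎 false false true χ) β ≡ bit (not (β (V 0 0))) + areaOf w χ β′
      areaOf-vertical𝟎 χ perfχ = trans (areaOf-𝟎 w μ β (trans (perfect-vertical𝟎 χ) perfχ) perfβ)
        (cong (bit (not (β (V 0 0))) +_) (areaOf-cong w {μ ∘ east} {χ} {β ∘ east} {β′} (λ _ _ → refl) β≗β′))
        where
        μ : EdgeSet
        μ = prepend𝟎 false false true χ

      areaOf-horizontal𝟎 : ∀ χ → χ (V 0 0) ≡ false → perfect w (insert (V 0 0) χ) ≡ true →
        areaOf (𝟎 ∷ w) (prepend𝟎 true true false χ) β ≡ bit (β (V 0 0)) + areaOf w (insert (V 0 0) χ) β′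
      areaOf-horizontal𝟎 χ χ₀₀ perfχ = trans (areaOf-𝟎 w μ β (trans (perfect-horizontal𝟎 χ χ₀₀) perfχ) perfβ)
        (cong (bit (β (V 0 0)) +_) (areaOf-cong w {μ ∘ east} {insert (V 0 0) χ} {β ∘ east} {β′}
          (λ x y → sym (insert-other {V 0 0} {V (suc x) y} χ (λ ()))) β≗β′))
        where
        μ : EdgeSet
        μ = prepend𝟎 true true false χ

    perfect-horizontal𝟏 : ∀ χ → perfect (𝟏 ∷ w) (prepend𝟏 true false false χ) ≡ perfect w χ
    perfect-horizontal𝟏 χ = trans (perfect-𝟏 w (prepend𝟏 true false false χ)) (perfect-cong w (prepend𝟏-north true false false χ))

    perfect-vertical𝟏 : ∀ χ → χ (H 0 0) ≡ false →
      perfect (𝟏 ∷ w) (prepend𝟏 false true true χ) ≡ perfect w (insert (H 0 0) χ)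
    perfect-vertical𝟏 χ χ₀₀ = trans (perfect-𝟏 w (prepend𝟏 false true true χ)) (trans
      (all-cong (λ v → cong (λ d → (bit (v ==ᴾ (0 , 0)) + (bit (v ==ᴾ (1 , 0)) + d)) ≡ᵇ 1)
        (count-cong (λ e → cong (_∧ touches v e) (prepend𝟏-north false true true χ e)) (edgeList w))) (vertexList w))
      (sym (perfect-insert-H00 w χ χ₀₀)))

    perfect-vertical𝟏-H00 : ∀ χ → perfect (𝟏 ∷ w) (prepend𝟏 false true true (insert (H 0 0) χ)) ≡ false
    perfect-vertical𝟏-H00 χ with perfect (𝟏 ∷ w) (prepend𝟏 false true true (insert (H 0 0) χ)) in perf
    ... | false = refl
    ... | true with split𝟏 w (prepend𝟏 false true true (insert (H 0 0) χ)) perf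
    ...   | horizontal () _ _ _
    ...   | vertical _ _ _ h₀₁ _ with () ← trans (sym h₀₁) (insert-self (H 0 0) χ)

    perp-horizontal𝟏 : ∀ χ → perp (𝟏 ∷ w) (prepend𝟏 true false false χ) ≡ not (isEven n)
    perp-horizontal𝟏 χ rewrite isEven-suc n with isEven n
    ... | true = refl
    ... | false = refl

    perp-vertical𝟏 : ∀ χ → perp (𝟏 ∷ w) (prepend𝟏 false true true χ) ≡ isEven n
    perp-vertical𝟏 χ rewrite isEven-suc n with isEven n
    ... | true = refl
    ... | false = refl

    module _ {β β′ : EdgeSet} (β≗β′ : ∀ x y → β (V x (suc y)) ≡ β′ (V x y)) where

      areaOf-horizontal𝟏 : ∀ χ → areaOf (𝟏 ∷ w) (prepend𝟏 true false false χ) β ≡ bit (β (V 1 0)) + areaOf w χ β′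
      areaOf-horizontal𝟏 χ = trans (areaOf-𝟏 w μ β)
        (cong (bit (β (V 1 0)) +_) (areaOf-cong w {μ ∘ north} {χ} {β ∘ north} {β′} (λ _ _ → refl) (β≗β′ ∘ suc)))
        where
        μ : EdgeSet
        μ = prepend𝟏 true false false χ

      areaOf-vertical𝟏 : ∀ χ →
        areaOf (𝟏 ∷ w) (prepend𝟏 false true true χ) β ≡ bit (not (β (V 1 0))) + areaOf w (insert (H 0 0) χ) β′
      areaOf-vertical𝟏 χ = trans (areaOf-𝟏 w μ β)
        (cong (bit (not (β (V 1 0))) +_) (areaOf-cong w {μ ∘ north} {insert (H 0 0) χ} {β ∘ north} {β′}
          (λ x y → sym (insert-other {H 0 0} {V (suc x) y} χ (λ ()))) (β≗β′ ∘ suc)))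
        where
        μ : EdgeSet
        μ = prepend𝟏 false true true χ

  imageEast imageNorth : EdgeSet → EdgeSet
  imageEast χ (H zero y) = false
  imageEast χ (H (suc x) y) = χ (H x y)
  imageEast χ (V zero y) = false
  imageEast χ (V (suc x) y) = χ (V x y)
  imageNorth χ (H x zero) = false
  imageNorth χ (H x (suc y)) = χ (H x y)
  imageNorth χ (V x zero) = false
  imageNorth χ (V x (suc y)) = χ (V x y)

  imageEast-∅ : ∀ e → imageEast (λ _ → false) e ≡ false
  imageEast-∅ (H zero _) = refl
  imageEast-∅ (H (suc _) _) = refl
  imageEast-∅ (V zero _) = refl
  imageEast-∅ (V (suc _) _) = refl

  imageNorth-∅ : ∀ e → imageNorth (λ _ → false) e ≡ false
  imageNorth-∅ (H _ zero) = refl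
  imageNorth-∅ (H _ (suc _)) = refl
  imageNorth-∅ (V _ zero) = refl
  imageNorth-∅ (V _ (suc _)) = refl

  insert-imageEast : ∀ x χ e → insert (east x) (imageEast χ) e ≡ imageEast (insert x χ) e
  insert-imageEast x χ e = trans (insert-≡ (east x) (imageEast χ) e) (trans (shifted x e) (sym (unshifted e)))
    where
    unshifted : ∀ e → imageEast (insert x χ) e ≡ imageEast (λ e → (e ==ᴱ x) ∨ χ e) e
    unshifted (H zero _) = refl
    unshifted (H (suc a) y) = insert-≡ x χ (H a y)
    unshifted (V zero _) = refl
    unshifted (V (suc a) y) = insert-≡ x χ (V a y)
    shifted : ∀ x e → ((e ==ᴱ east x) ∨ imageEast χ e) ≡ imageEast (λ e → (e ==ᴱ x) ∨ χ e) e
    shifted (H _ _) (H zero _) = refl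
    shifted (H _ _) (H (suc _) _) = refl
    shifted (H _ _) (V zero _) = refl
    shifted (H _ _) (V (suc _) _) = refl
    shifted (V _ _) (H zero _) = refl
    shifted (V _ _) (H (suc _) _) = refl
    shifted (V _ _) (V zero _) = refl
    shifted (V _ _) (V (suc _) _) = refl

  insert-imageNorth : ∀ x χ e → insert (north x) (imageNorth χ) e ≡ imageNorth (insert x χ) e
  insert-imageNorth x χ e = trans (insert-≡ (north x) (imageNorth χ) e) (trans (shifted x e) (sym (unshifted e)))
    where
    unshifted : ∀ e → imageNorth (insert x χ) e ≡ imageNorth (λ e → (e ==ᴱ x) ∨ χ e) e
    unshifted (H _ zero) = refl
    unshifted (H y (suc a)) = insert-≡ x χ (H y a)
    unshifted (V _ zero) = refl
    unshifted (V y (suc a)) = insert-≡ x χ (V y a)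
    shifted : ∀ x e → ((e ==ᴱ north x) ∨ imageNorth χ e) ≡ imageNorth (λ e → (e ==ᴱ x) ∨ χ e) e
    shifted (H _ _) (H y zero) = trans (∨-identityʳ _) (∧-zeroʳ _)
    shifted (H _ _) (H _ (suc _)) = refl
    shifted (H _ _) (V _ zero) = refl
    shifted (H _ _) (V _ (suc _)) = refl
    shifted (V _ _) (H _ zero) = refl
    shifted (V _ _) (H _ (suc _)) = refl
    shifted (V _ _) (V y zero) = trans (∨-identityʳ _) (∧-zeroʳ _)
    shifted (V _ _) (V _ (suc _)) = refl

  insertIf : Bool → Edge → EdgeSet → EdgeSet
  insertIf true x χ = insert x χ
  insertIf false x χ = χ

  insertIf-≡ : ∀ b x χ e → insertIf b x χ e ≡ ((e ==ᴱ x) ∧ b) ∨ χ e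
  insertIf-≡ true x χ e = trans (insert-≡ x χ e) (cong (_∨ χ e) (sym (∧-identityʳ (e ==ᴱ x))))
  insertIf-≡ false x χ e = cong (_∨ χ e) (sym (∧-zeroʳ (e ==ᴱ x)))

  insertIf-imageEast : ∀ h₀₀ h₀₁ v₀₀ χ e →
    insertIf h₀₀ (H 0 0) (insertIf h₀₁ (H 0 1) (insertIf v₀₀ (V 0 0) (imageEast χ))) e ≡ prepend𝟎 h₀₀ h₀₁ v₀₀ χ e
  insertIf-imageEast h₀₀ h₀₁ v₀₀ χ e
    rewrite insertIf-≡ h₀₀ (H 0 0) (insertIf h₀₁ (H 0 1) (insertIf v₀₀ (V 0 0) (imageEast χ))) e
          | insertIf-≡ h₀₁ (H 0 1) (insertIf v₀₀ (V 0 0) (imageEast χ)) e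
          | insertIf-≡ v₀₀ (V 0 0) (imageEast χ) e = by-cases e
    where
    by-cases : ∀ e → ((e ==ᴱ H 0 0) ∧ h₀₀) ∨ (((e ==ᴱ H 0 1) ∧ h₀₁) ∨ (((e ==ᴱ V 0 0) ∧ v₀₀) ∨ imageEast χ e))
                     ≡ prepend𝟎 h₀₀ h₀₁ v₀₀ χ e
    by-cases (H zero zero) = ∨-identityʳ h₀₀
    by-cases (H zero (suc zero)) = ∨-identityʳ h₀₁
    by-cases (H zero (suc (suc _))) = refl
    by-cases (H (suc _) _) = refl
    by-cases (V zero zero) = ∨-identityʳ v₀₀
    by-cases (V zero (suc _)) = refl
    by-cases (V (suc _) _) = refl

  insertIf-imageNorth : ∀ h₀₀ v₀₀ v₁₀ χ e →
    insertIf h₀₀ (H 0 0) (insertIf v₀₀ (V 0 0) (insertIf v₁₀ (V 1 0) (imageNorth χ))) e ≡ prepend𝟏 h₀₀ v₀₀ v₁₀ χ e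
  insertIf-imageNorth h₀₀ v₀₀ v₁₀ χ e
    rewrite insertIf-≡ h₀₀ (H 0 0) (insertIf v₀₀ (V 0 0) (insertIf v₁₀ (V 1 0) (imageNorth χ))) e
          | insertIf-≡ v₀₀ (V 0 0) (insertIf v₁₀ (V 1 0) (imageNorth χ)) e
          | insertIf-≡ v₁₀ (V 1 0) (imageNorth χ) e = by-cases e
    where
    by-cases : ∀ e → ((e ==ᴱ H 0 0) ∧ h₀₀) ∨ (((e ==ᴱ V 0 0) ∧ v₀₀) ∨ (((e ==ᴱ V 1 0) ∧ v₁₀) ∨ imageNorth χ e))
                     ≡ prepend𝟏 h₀₀ v₀₀ v₁₀ χ e
    by-cases (H zero (suc _)) = refl
    by-cases (H (suc _) (suc _)) = refl
    by-cases (H zero zero) = ∨-identityʳ h₀₀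
    by-cases (H (suc _) zero) = refl
    by-cases (V zero (suc _)) = refl
    by-cases (V (suc zero) (suc _)) = refl
    by-cases (V (suc (suc _)) (suc _)) = refl
    by-cases (V zero zero) = ∨-identityʳ v₀₀
    by-cases (V (suc zero) zero) = ∨-identityʳ v₁₀
    by-cases (V (suc (suc _)) zero) = refl

  insert-cong : ∀ x {χ χ′ : EdgeSet} → (∀ e → χ e ≡ χ′ e) → ∀ e → insert x χ e ≡ insert x χ′ e
  insert-cong x χ≗χ′ e = cong (⌊ e ≟E x ⌋ ∨_) (χ≗χ′ e)

  insertIf-cong : ∀ b x {χ χ′ : EdgeSet} → (∀ e → χ e ≡ χ′ e) → ∀ e → insertIf b x χ e ≡ insertIf b x χ′ e
  insertIf-cong true x = insert-cong x
  insertIf-cong false x χ≗χ′ = χ≗χ′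

  edgeList∖V00 : Word → List Edge
  edgeList∖V00 [] = H 0 0 ∷ H 0 1 ∷ V 1 0 ∷ []
  edgeList∖V00 (𝟎 ∷ w) = H 0 0 ∷ H 0 1 ∷ map east (edgeList w)
  edgeList∖V00 (𝟏 ∷ w) = H 0 0 ∷ V 1 0 ∷ map north (edgeList w)

  edgeList↭V00∷ : ∀ w → edgeList w ↭ V 0 0 ∷ edgeList∖V00 w
  edgeList↭V00∷ [] = ↭.trans (↭.prep (H 0 0) (↭.swap (H 0 1) (V 0 0) ↭.refl)) (↭.swap (H 0 0) (V 0 0) ↭.refl)
  edgeList↭V00∷ (𝟎 ∷ w) = ↭.trans (↭.prep (H 0 0) (↭.swap (H 0 1) (V 0 0) ↭.refl)) (↭.swap (H 0 0) (V 0 0) ↭.refl)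
  edgeList↭V00∷ (𝟏 ∷ w) = ↭.swap (H 0 0) (V 0 0) ↭.refl

  V00∉edgeList∖V00 : ∀ w → V 0 0 ∉ edgeList∖V00 w
  V00∉edgeList∖V00 [] (there (there (here ())))
  V00∉edgeList∖V00 [] (there (there (there ())))
  V00∉edgeList∖V00 (𝟎 ∷ w) (there (there V00∈)) with ∈-map⁻ east V00∈
  ... | H _ _ , _ , ()
  ... | V _ _ , _ , ()
  V00∉edgeList∖V00 (𝟏 ∷ w) (there (there V00∈)) with ∈-map⁻ north V00∈
  ... | H _ _ , _ , ()
  ... | V _ _ , _ , ()

  edgeList∖H00 : Word → List Edge
  edgeList∖H00 [] = H 0 1 ∷ V 0 0 ∷ V 1 0 ∷ []
  edgeList∖H00 (𝟎 ∷ w) = H 0 1 ∷ V 0 0 ∷ map east (edgeList w)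
  edgeList∖H00 (𝟏 ∷ w) = V 0 0 ∷ V 1 0 ∷ map north (edgeList w)

  edgeList↭H00∷ : ∀ w → edgeList w ↭ H 0 0 ∷ edgeList∖H00 w
  edgeList↭H00∷ [] = ↭.refl
  edgeList↭H00∷ (𝟎 ∷ w) = ↭.refl
  edgeList↭H00∷ (𝟏 ∷ w) = ↭.refl

  H00∉edgeList∖H00 : ∀ w → H 0 0 ∉ edgeList∖H00 w
  H00∉edgeList∖H00 [] (there (there (there ())))
  H00∉edgeList∖H00 (𝟎 ∷ w) (there (there H00∈)) with ∈-map⁻ east H00∈
  ... | H _ _ , _ , ()
  ... | V _ _ , _ , ()
  H00∉edgeList∖H00 (𝟏 ∷ w) (there (there H00∈)) with ∈-map⁻ north H00∈
  ... | H _ _ , _ , ()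
  ... | V _ _ , _ , ()

  letter : Bool → Letter
  letter true = 𝟎
  letter false = 𝟏

  θ-𝟎 : ∀ w → θ (𝟎 ∷ w) ≡ letter (not (isEven (length w))) ∷ θ w
  θ-𝟎 w with isEven (length w)
  ... | true = refl
  ... | false = refl

  θ-𝟏 : ∀ w → θ (𝟏 ∷ w) ≡ letter (isEven (length w)) ∷ θ w
  θ-𝟏 w with isEven (length w)
  ... | true = refl
  ... | false = refl

  areaOf-congᴸ : ∀ w μ {β β′ : EdgeSet} → (∀ {e} → e ∈ edgeList w → β e ≡ β′ e) → areaOf w μ β ≡ areaOf w μ β′
  areaOf-congᴸ w μ β≗β′ = sumBelow-cong N (λ a → sumBelow-cong N (λ c → cong bit (cong isOdd
    (count-congᴸ (edgeList w) (λ {e} e∈ → cong (λ b → (μ e xor b) ∧ crosses a c e) (β≗β′ e∈))))))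
    where
    N : ℕ
    N = suc (suc (length w))

module AreaSums {c ℓ} (R : CommutativeRing c ℓ) (q : CommutativeRing.Carrier R) where

  open Matchings
  open CommutativeRing R
  open OverRing R
  open import Relation.Binary.Reasoning.Setoid setoid
  open import Algebra.Properties.CommutativeSemigroup +-commutativeSemigroup using (interchange)
  open import Data.Bool using (Bool; true; false; not; _∧_; if_then_else_)
  open import Data.Bool.Properties using (∧-identityʳ; not-involutive; ¬-not)
  open import Data.List using (List; []; _∷_; _++_; map; filterᵇ; foldr; length)
  open import Data.List.Properties using (foldr-map)
  open import Data.List.Membership.Propositional using (_∈_)
  open import Data.List.Membership.Propositional.Properties using (∈-map⁺; ∈-++⁺ˡ; ∈-++⁺ʳ)
  open import Data.List.Relation.Binary.Permutation.Propositional as ↭ using (_↭_)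
  open import Data.List.Relation.Unary.Any using (here; there)
  open import Function using (_∘_)
  open import Data.Nat using (ℕ; zero; suc)
  import Data.Nat as ℕ
  open import Data.Product using (_×_; _,_; proj₁; proj₂)
  open import Relation.Nullary using (yes; no; ⌊_⌋)
  import Relation.Binary.PropositionalEquality as ≡
  open ≡ using (_≡_)

  Σ⊆ : List Edge → (EdgeSet → Carrier) → Carrier
  Σ⊆ [] F = F (λ _ → false)
  Σ⊆ (x ∷ L) F = Σ⊆ L (F ∘ insert x) + Σ⊆ L F

  Extensional : (EdgeSet → Carrier) → Set _
  Extensional F = ∀ {χ χ′} → (∀ e → χ e ≡ χ′ e) → F χ ≈ F χ′

  SupportedIn : List Edge → EdgeSet → Set
  SupportedIn L χ = ∀ {e} → χ e ≡ true → e ∈ L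

  Σ⊆-cong-supported : ∀ L {F G} → (∀ χ → SupportedIn L χ → F χ ≈ G χ) → Σ⊆ L F ≈ Σ⊆ L G
  Σ⊆-cong-supported [] F≈G = F≈G _ (λ ())
  Σ⊆-cong-supported (x ∷ L) F≈G =
    +-cong (Σ⊆-cong-supported L (λ χ χ⊆L → F≈G (insert x χ) (insert-supported χ⊆L)))
           (Σ⊆-cong-supported L (λ χ χ⊆L → F≈G χ (there ∘ χ⊆L)))
    where
    insert-supported : ∀ {χ} → SupportedIn L χ → SupportedIn (x ∷ L) (insert x χ)
    insert-supported {χ} χ⊆L {e} e∈ with e ≟E x
    ... | yes ≡.refl = here ≡.refl
    ... | no _ = there (χ⊆L e∈)

  Σ⊆-cong : ∀ L {F G} → (∀ χ → F χ ≈ G χ) → Σ⊆ L F ≈ Σ⊆ L G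
  Σ⊆-cong L F≈G = Σ⊆-cong-supported L (λ χ _ → F≈G χ)

  Σ⊆-zero : ∀ L {F} → (∀ χ → F χ ≈ 0#) → Σ⊆ L F ≈ 0#
  Σ⊆-zero [] F≈0 = F≈0 _
  Σ⊆-zero (x ∷ L) F≈0 = trans (+-cong (Σ⊆-zero L (F≈0 ∘ insert x)) (Σ⊆-zero L F≈0)) (+-identityˡ 0#)

  Σ⊆-+ : ∀ L (F G : EdgeSet → Carrier) → Σ⊆ L (λ χ → F χ + G χ) ≈ Σ⊆ L F + Σ⊆ L G
  Σ⊆-+ [] F G = refl
  Σ⊆-+ (x ∷ L) F G = trans (+-cong (Σ⊆-+ L _ _) (Σ⊆-+ L F G)) (interchange _ _ _ _)

  Σ⊆-*ˡ : ∀ L a (F : EdgeSet → Carrier) → Σ⊆ L (λ χ → a * F χ) ≈ a * Σ⊆ L F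
  Σ⊆-*ˡ [] a F = refl
  Σ⊆-*ˡ (x ∷ L) a F = trans (+-cong (Σ⊆-*ˡ L a _) (Σ⊆-*ˡ L a F)) (sym (distribˡ a _ _))

  insert-extensional : ∀ x {F} → Extensional F → Extensional (F ∘ insert x)
  insert-extensional x F-ext χ≗χ′ = F-ext (insert-cong x χ≗χ′)

  Σ⊆-↭ : ∀ {L L′} → L ↭ L′ → ∀ F → Extensional F → Σ⊆ L F ≈ Σ⊆ L′ F
  Σ⊆-↭ ↭.refl F F-ext = refl
  Σ⊆-↭ (↭.prep x L↭L′) F F-ext = +-cong (Σ⊆-↭ L↭L′ _ (insert-extensional x F-ext)) (Σ⊆-↭ L↭L′ F F-ext)
  Σ⊆-↭ {x ∷ y ∷ L} {.y ∷ .x ∷ L′} (↭.swap .x .y L↭L′) F F-ext = begin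
    (Σ⊆ L (F ∘ insert x ∘ insert y) + Σ⊆ L (F ∘ insert x)) + (Σ⊆ L (F ∘ insert y) + Σ⊆ L F)
      ≈⟨ interchange _ _ _ _ ⟩
    (Σ⊆ L (F ∘ insert x ∘ insert y) + Σ⊆ L (F ∘ insert y)) + (Σ⊆ L (F ∘ insert x) + Σ⊆ L F)
      ≈⟨ +-cong (+-cong (Σ⊆-cong L (λ χ → F-ext (insert-comm χ))) refl) refl ⟩
    (Σ⊆ L (F ∘ insert y ∘ insert x) + Σ⊆ L (F ∘ insert y)) + (Σ⊆ L (F ∘ insert x) + Σ⊆ L F)
      ≈⟨ +-cong (+-cong (Σ⊆-↭ L↭L′ _ (insert-extensional x (insert-extensional y F-ext)))
                        (Σ⊆-↭ L↭L′ _ (insert-extensional y F-ext)))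
                (+-cong (Σ⊆-↭ L↭L′ _ (insert-extensional x F-ext)) (Σ⊆-↭ L↭L′ F F-ext)) ⟩
    (Σ⊆ L′ (F ∘ insert y ∘ insert x) + Σ⊆ L′ (F ∘ insert y)) + (Σ⊆ L′ (F ∘ insert x) + Σ⊆ L′ F) ∎
    where
    insert-comm : ∀ χ e → insert x (insert y χ) e ≡ insert y (insert x χ) e
    insert-comm χ e with ⌊ e ≟E x ⌋ | ⌊ e ≟E y ⌋
    ... | true | true = ≡.refl
    ... | true | false = ≡.refl
    ... | false | true = ≡.refl
    ... | false | false = ≡.refl
  Σ⊆-↭ (↭.trans L↭L′ L′↭L″) F F-ext = trans (Σ⊆-↭ L↭L′ F F-ext) (Σ⊆-↭ L′↭L″ F F-ext)

  Σ⊆-map : ∀ {shift : Edge → Edge} {image : EdgeSet → EdgeSet} →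
    (∀ e → image (λ _ → false) e ≡ false) → (∀ x χ e → insert (shift x) (image χ) e ≡ image (insert x χ) e) →
    ∀ L F → Extensional F → Σ⊆ (map shift L) F ≈ Σ⊆ L (F ∘ image)
  Σ⊆-map image-∅ insert-image [] F F-ext = F-ext (λ e → ≡.sym (image-∅ e))
  Σ⊆-map {shift} image-∅ insert-image (x ∷ L) F F-ext = +-cong
    (trans (Σ⊆-map image-∅ insert-image L _ (insert-extensional (shift x) F-ext))
           (Σ⊆-cong L (λ χ → F-ext (insert-image x χ))))
    (Σ⊆-map image-∅ insert-image L F F-ext)

  weightIf : Bool → ℕ → Carrier
  weightIf s n = if s then pow q n else 0#

  _==ᵇ_ : Bool → Bool → Bool
  true ==ᵇ b = b
  false ==ᵇ b = not b

  -- Class t = true is M⊥ and t = false is M∥.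
  weight : Word → EdgeSet → Bool → EdgeSet → Carrier
  weight w β t χ = weightIf (perfect w χ ∧ (t ==ᵇ perp w χ)) (areaOf w χ β)

  Σarea : Word → EdgeSet → Bool → Carrier
  Σarea w β t = Σ⊆ (edgeList w) (weight w β t)

  weight-extensional : ∀ w β t → Extensional (weight w β t)
  weight-extensional w β t {χ} {χ′} χ≗χ′ = reflexive (≡.cong₂ weightIf
    (≡.cong₂ (λ p c → p ∧ (t ==ᵇ c)) (perfect-cong w χ≗χ′) (perp-cong w χ≗χ′))
    (areaOf-cong w {χ} {χ′} {β} {β} (λ x y → χ≗χ′ (V (suc x) y)) (λ _ _ → ≡.refl)))

  sumOver : (List Edge → Carrier) → List (List Edge) → Carrier
  sumOver g = foldr (λ m s → g m + s) 0#

  sumOver-++ : ∀ g xs ys → sumOver g (xs ++ ys) ≈ sumOver g xs + sumOver g ys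
  sumOver-++ g [] ys = sym (+-identityˡ _)
  sumOver-++ g (x ∷ xs) ys = trans (+-cong refl (sumOver-++ g xs ys)) (sym (+-assoc _ _ _))

  sumOver-filterᵇ : ∀ (P : List Edge → Bool) g ms →
    sumOver g (filterᵇ P ms) ≈ sumOver (λ m → if P m then g m else 0#) ms
  sumOver-filterᵇ P g [] = refl
  sumOver-filterᵇ P g (m ∷ ms) with P m
  ... | true = +-cong refl (sumOver-filterᵇ P g ms)
  ... | false = trans (sumOver-filterᵇ P g ms) (sym (+-identityˡ _))

  sumOver-subsets : ∀ L (G : EdgeSet → Carrier) g → (∀ {m} → m ∈ subsets L → g m ≈ G (_∈ᵇ m)) →
    sumOver g (subsets L) ≈ Σ⊆ L G
  sumOver-subsets [] G g g≈G = trans (+-identityʳ _) (g≈G (here ≡.refl))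
  sumOver-subsets (x ∷ L) G g g≈G = begin
    sumOver g (map (x ∷_) (subsets L) ++ subsets L)
      ≈⟨ sumOver-++ g (map (x ∷_) (subsets L)) (subsets L) ⟩
    sumOver g (map (x ∷_) (subsets L)) + sumOver g (subsets L)
      ≡⟨ ≡.cong (_+ sumOver g (subsets L)) (foldr-map _ (x ∷_) 0# (subsets L)) ⟩
    sumOver (g ∘ (x ∷_)) (subsets L) + sumOver g (subsets L)
      ≈⟨ +-cong (sumOver-subsets L (G ∘ insert x) (g ∘ (x ∷_)) (g≈G ∘ ∈-++⁺ˡ ∘ ∈-map⁺ (x ∷_)))
                (sumOver-subsets L G g (g≈G ∘ ∈-++⁺ʳ (map (x ∷_) (subsets L)))) ⟩
    Σ⊆ (x ∷ L) G ∎

  areaSum≈Σarea : ∀ w b t → areaSum q w b (filterᵇ (λ m → t ==ᵇ isPerp w m) (matchings w)) ≈ Σarea w (_∈ᵇ b) t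
  areaSum≈Σarea w b t = begin
    sumOver g (filterᵇ inClass (filterᵇ (isPerfect w) (subsets (edgesG w))))
      ≈⟨ sumOver-filterᵇ inClass g (filterᵇ (isPerfect w) (subsets (edgesG w))) ⟩
    sumOver (λ m → if inClass m then g m else 0#) (filterᵇ (isPerfect w) (subsets (edgesG w)))
      ≈⟨ sumOver-filterᵇ (isPerfect w) (λ m → if inClass m then g m else 0#) (subsets (edgesG w)) ⟩
    sumOver (λ m → if isPerfect w m then (if inClass m then g m else 0#) else 0#) (subsets (edgesG w))
      ≈⟨ sumOver-subsets (edgesG w) (weight w (_∈ᵇ b) t) _ pointwise ⟩
    Σ⊆ (edgesG w) (weight w (_∈ᵇ b) t)
      ≈⟨ Σ⊆-↭ (edgesG↭edgeList w) _ (weight-extensional w (_∈ᵇ b) t) ⟩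
    Σarea w (_∈ᵇ b) t ∎
    where
    g : List Edge → Carrier
    g m = pow q (area w m b)
    inClass : List Edge → Bool
    inClass m = t ==ᵇ isPerp w m
    pointwise : ∀ {m} → m ∈ subsets (edgesG w) →
      (if isPerfect w m then (if inClass m then g m else 0#) else 0#) ≈ weight w (_∈ᵇ b) t (_∈ᵇ m)
    pointwise {m} m∈ rewrite isPerfect≡perfect w m∈ | area≡areaOf w m b with perfect w (_∈ᵇ m)
    ... | true = refl
    ... | false = refl

  module _ {a b : Carrier} where

    +-dropˡ : a ≈ 0# → a + b ≈ b
    +-dropˡ a≈0 = trans (+-cong a≈0 refl) (+-identityˡ b)

    +-dropʳ : b ≈ 0# → a + b ≈ a
    +-dropʳ b≈0 = trans (+-cong refl b≈0) (+-identityʳ a)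

  module _ {a b c d : Carrier} where

    only₁ : b ≈ 0# → c ≈ 0# → d ≈ 0# → (a + b) + (c + d) ≈ a
    only₁ b≈0 c≈0 d≈0 = trans (+-cong (trans (+-cong refl b≈0) (+-identityʳ a)) (trans (+-cong c≈0 d≈0) (+-identityˡ 0#)))
                              (+-identityʳ a)

    only₂ : a ≈ 0# → c ≈ 0# → d ≈ 0# → (a + b) + (c + d) ≈ b
    only₂ a≈0 c≈0 d≈0 = trans (+-cong (trans (+-cong a≈0 refl) (+-identityˡ b)) (trans (+-cong c≈0 d≈0) (+-identityˡ 0#)))
                              (+-identityʳ b)

    only₃ : a ≈ 0# → b ≈ 0# → d ≈ 0# → (a + b) + (c + d) ≈ c
    only₃ a≈0 b≈0 d≈0 = trans (+-cong (trans (+-cong a≈0 b≈0) (+-identityˡ 0#)) (trans (+-cong refl d≈0) (+-identityʳ c)))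
                              (+-identityˡ c)

    only₄ : a ≈ 0# → b ≈ 0# → c ≈ 0# → (a + b) + (c + d) ≈ d
    only₄ a≈0 b≈0 c≈0 = trans (+-cong (trans (+-cong a≈0 b≈0) (+-identityˡ 0#)) (trans (+-cong c≈0 refl) (+-identityˡ d)))
                              (+-identityˡ d)

  module _ (w : Word) (F : EdgeSet → Carrier) (F-ext : Extensional F)
           (F-perfect : ∀ χ → perfect (𝟎 ∷ w) χ ≡ false → F χ ≈ 0#) where

    private
      leaf : Bool → Bool → Bool → Carrier
      leaf h₀₀ h₀₁ v₀₀ = Σ⊆ (map east (edgeList w)) (λ χ → F (insertIf h₀₀ (H 0 0) (insertIf h₀₁ (H 0 1) (insertIf v₀₀ (V 0 0) χ))))

      leaf≈ : ∀ h₀₀ h₀₁ v₀₀ → leaf h₀₀ h₀₁ v₀₀ ≈ Σ⊆ (edgeList w) (F ∘ prepend𝟎 h₀₀ h₀₁ v₀₀)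
      leaf≈ h₀₀ h₀₁ v₀₀ =
        trans (Σ⊆-map imageEast-∅ insert-imageEast (edgeList w) _
                 (F-ext ∘ insertIf-cong h₀₀ (H 0 0) ∘ insertIf-cong h₀₁ (H 0 1) ∘ insertIf-cong v₀₀ (V 0 0)))
              (Σ⊆-cong (edgeList w) (λ χ → F-ext (insertIf-imageEast h₀₀ h₀₁ v₀₀ χ)))

      dead : ∀ h₀₀ h₀₁ v₀₀ → (∀ χ → perfect (𝟎 ∷ w) (prepend𝟎 h₀₀ h₀₁ v₀₀ χ) ≡ false) → leaf h₀₀ h₀₁ v₀₀ ≈ 0#
      dead h₀₀ h₀₁ v₀₀ imperfect = trans (leaf≈ h₀₀ h₀₁ v₀₀) (Σ⊆-zero (edgeList w) (λ χ → F-perfect _ (imperfect χ)))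

    Σ⊆-𝟎 : Σ⊆ (edgeList (𝟎 ∷ w)) F
         ≈ Σ⊆ (edgeList w) (F ∘ prepend𝟎 true true false) + Σ⊆ (edgeList w) (F ∘ prepend𝟎 false false true)
    Σ⊆-𝟎 = +-cong
      (trans (only₂ (dead true true true (perfect-𝟎 w ∘ prepend𝟎 true true true))
                    (dead true false true (perfect-𝟎 w ∘ prepend𝟎 true false true))
                    (dead true false false (perfect-𝟎 w ∘ prepend𝟎 true false false)))
             (leaf≈ true true false))
      (trans (only₃ (dead false true true (perfect-𝟎 w ∘ prepend𝟎 false true true))
                    (dead false true false (perfect-𝟎 w ∘ prepend𝟎 false true false))
                    (dead false false false (perfect-𝟎 w ∘ prepend𝟎 false false false)))
             (leaf≈ false false true))

  module _ (w : Word) (F : EdgeSet → Carrier) (F-ext : Extensional F)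
           (F-perfect : ∀ χ → perfect (𝟏 ∷ w) χ ≡ false → F χ ≈ 0#) where

    private
      leaf : Bool → Bool → Bool → Carrier
      leaf h₀₀ v₀₀ v₁₀ = Σ⊆ (map north (edgeList w)) (λ χ → F (insertIf h₀₀ (H 0 0) (insertIf v₀₀ (V 0 0) (insertIf v₁₀ (V 1 0) χ))))

      leaf≈ : ∀ h₀₀ v₀₀ v₁₀ → leaf h₀₀ v₀₀ v₁₀ ≈ Σ⊆ (edgeList w) (F ∘ prepend𝟏 h₀₀ v₀₀ v₁₀)
      leaf≈ h₀₀ v₀₀ v₁₀ =
        trans (Σ⊆-map imageNorth-∅ insert-imageNorth (edgeList w) _
                 (F-ext ∘ insertIf-cong h₀₀ (H 0 0) ∘ insertIf-cong v₀₀ (V 0 0) ∘ insertIf-cong v₁₀ (V 1 0)))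
              (Σ⊆-cong (edgeList w) (λ χ → F-ext (insertIf-imageNorth h₀₀ v₀₀ v₁₀ χ)))

      dead : ∀ h₀₀ v₀₀ v₁₀ → (∀ χ → perfect (𝟏 ∷ w) (prepend𝟏 h₀₀ v₀₀ v₁₀ χ) ≡ false) → leaf h₀₀ v₀₀ v₁₀ ≈ 0#
      dead h₀₀ v₀₀ v₁₀ imperfect = trans (leaf≈ h₀₀ v₀₀ v₁₀) (Σ⊆-zero (edgeList w) (λ χ → F-perfect _ (imperfect χ)))

    Σ⊆-𝟏 : Σ⊆ (edgeList (𝟏 ∷ w)) F
         ≈ Σ⊆ (edgeList w) (F ∘ prepend𝟏 true false false) + Σ⊆ (edgeList w) (F ∘ prepend𝟏 false true true)
    Σ⊆-𝟏 = +-cong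
      (trans (only₄ (dead true true true (perfect-𝟏 w ∘ prepend𝟏 true true true))
                    (dead true true false (perfect-𝟏 w ∘ prepend𝟏 true true false))
                    (dead true false true (perfect-𝟏 w ∘ prepend𝟏 true false true)))
             (leaf≈ true false false))
      (trans (only₁ (dead false true false (perfect-𝟏 w ∘ prepend𝟏 false true false))
                    (dead false false true (perfect-𝟏 w ∘ prepend𝟏 false false true))
                    (dead false false false (perfect-𝟏 w ∘ prepend𝟏 false false false)))
             (leaf≈ false true true))

  ==ᵇ-refl : ∀ b → (b ==ᵇ b) ≡ true
  ==ᵇ-refl true = ≡.refl
  ==ᵇ-refl false = ≡.refl

  ==ᵇ-not : ∀ b → (b ==ᵇ not b) ≡ false
  ==ᵇ-not true = ≡.refl
  ==ᵇ-not false = ≡.refl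

  not-==ᵇ : ∀ b → (not b ==ᵇ b) ≡ false
  not-==ᵇ true = ≡.refl
  not-==ᵇ false = ≡.refl

  pow-+ : ∀ m n → pow q (m ℕ.+ n) ≈ pow q m * pow q n
  pow-+ zero n = sym (*-identityˡ _)
  pow-+ (suc m) n = trans (*-cong refl (pow-+ m n)) (sym (*-assoc q _ _))

  weightIf-cong : ∀ {s s′ n n′} → s ≡ s′ → (s′ ≡ true → n ≡ n′) → weightIf s n ≈ weightIf s′ n′
  weightIf-cong {s′ = false} ≡.refl n≡n′ = refl
  weightIf-cong {s′ = true} ≡.refl n≡n′ rewrite n≡n′ ≡.refl = refl

  weightIf-∧-false : ∀ s n → weightIf (s ∧ false) n ≈ 0#
  weightIf-∧-false true n = refl
  weightIf-∧-false false n = refl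

  weightIf-+ : ∀ s k n → weightIf s (k ℕ.+ n) ≈ pow q k * weightIf s n
  weightIf-+ true k n = pow-+ k n
  weightIf-+ false k n = sym (zeroʳ _)

  weight-imperfect : ∀ w β t χ → perfect w χ ≡ false → weight w β t χ ≈ 0#
  weight-imperfect w β t χ imperfect rewrite imperfect = refl

  Σperfect : Word → EdgeSet → Carrier
  Σperfect w β = Σ⊆ (edgeList w) (λ χ → weightIf (perfect w χ) (areaOf w χ β))

  Σperfect≈Σarea⊥+Σarea∥ : ∀ w β → Σperfect w β ≈ Σarea w β true + Σarea w β false
  Σperfect≈Σarea⊥+Σarea∥ w β =
    trans (Σ⊆-cong (edgeList w) (λ χ → split-class (perfect w χ) (perp w χ) (areaOf w χ β))) (Σ⊆-+ (edgeList w) _ _)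
    where
    split-class : ∀ s c n → weightIf s n ≈ weightIf (s ∧ (true ==ᵇ c)) n + weightIf (s ∧ (false ==ᵇ c)) n
    split-class true true n = sym (+-identityʳ _)
    split-class true false n = sym (+-identityˡ _)
    split-class false c n = sym (+-identityˡ 0#)

  module _ (w : Word) (β : EdgeSet) where

    private
      e : Bool
      e = isEven (length w)

    Σarea-with-V00 : Σarea w β (not e) ≈ Σ⊆ (edgeList∖V00 w) (weight w β (not e) ∘ insert (V 0 0))
    Σarea-with-V00 = begin
      Σarea w β (not e)
        ≈⟨ Σ⊆-↭ (edgeList↭V00∷ w) _ (weight-extensional w β (not e)) ⟩
      Σ⊆ (edgeList∖V00 w) (weight w β (not e) ∘ insert (V 0 0)) + Σ⊆ (edgeList∖V00 w) (weight w β (not e))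
        ≈⟨ +-dropʳ (trans (Σ⊆-cong-supported (edgeList∖V00 w) without-V00) (Σ⊆-zero (edgeList∖V00 w) (λ _ → refl))) ⟩
      Σ⊆ (edgeList∖V00 w) (weight w β (not e) ∘ insert (V 0 0)) ∎
      where
      without-V00 : ∀ χ → SupportedIn (edgeList∖V00 w) χ → weight w β (not e) χ ≈ 0#
      without-V00 χ χ⊆ with perfect w χ in perf
      ... | false = refl
      ... | true rewrite perp-without-V00 w χ perf (¬-not (λ V00∈χ → V00∉edgeList∖V00 w (χ⊆ V00∈χ))) | not-==ᵇ e = refl

    Σarea-with-H00 : Σarea w β e ≈ Σ⊆ (edgeList∖H00 w) (weight w β e ∘ insert (H 0 0))
    Σarea-with-H00 = begin
      Σarea w β e
        ≈⟨ Σ⊆-↭ (edgeList↭H00∷ w) _ (weight-extensional w β e) ⟩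
      Σ⊆ (edgeList∖H00 w) (weight w β e ∘ insert (H 0 0)) + Σ⊆ (edgeList∖H00 w) (weight w β e)
        ≈⟨ +-dropʳ (trans (Σ⊆-cong-supported (edgeList∖H00 w) without-H00) (Σ⊆-zero (edgeList∖H00 w) (λ _ → refl))) ⟩
      Σ⊆ (edgeList∖H00 w) (weight w β e ∘ insert (H 0 0)) ∎
      where
      without-H00 : ∀ χ → SupportedIn (edgeList∖H00 w) χ → weight w β e χ ≈ 0#
      without-H00 χ χ⊆ with perfect w χ in perf
      ... | false = refl
      ... | true rewrite perp-with-V00 w χ perf
                           (≡.trans (exactly-one (χ (H 0 0)) (χ (V 0 0)) (perfect⇒origin w χ perf))
                                    (≡.cong not (¬-not (λ H00∈χ → H00∉edgeList∖H00 w (χ⊆ H00∈χ)))))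
                       | ==ᵇ-not e = refl

  -- The recursion for the class sums

  Σ⊆-weightIf-∧ : ∀ L (P : EdgeSet → Bool) (n : EdgeSet → ℕ) s →
    Σ⊆ L (λ χ → weightIf (P χ ∧ s) (n χ)) ≈ (if s then Σ⊆ L (λ χ → weightIf (P χ) (n χ)) else 0#)
  Σ⊆-weightIf-∧ L P n true = Σ⊆-cong L (λ χ → reflexive (≡.cong (λ s → weightIf s (n χ)) (∧-identityʳ (P χ))))
  Σ⊆-weightIf-∧ L P n false = Σ⊆-zero L (λ χ → weightIf-∧-false (P χ) (n χ))

  ∧-trueˡ : ∀ {a b} → a ∧ b ≡ true → a ≡ true
  ∧-trueˡ {true} _ = ≡.refl

  ∧-congʳ-if : ∀ a {b b′} → (a ≡ true → b ≡ b′) → a ∧ b ≡ a ∧ b′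
  ∧-congʳ-if true b≡b′ = b≡b′ ≡.refl
  ∧-congʳ-if false _ = ≡.refl

  -- With e = isEven |w|, the matchings of G(𝟎w) of class e contain V00 and
  -- restrict to any perfect matching of G(w) ("full"); those of class ¬e contain
  -- H00 and H01 and restrict, after adding V00, to the matchings of G(w) of class
  -- ¬e ("restricted").  For G(𝟏w) the roles of e and ¬e are exchanged.
  module Step𝟎 (w : Word) {β β′ : EdgeSet} (perfβ : perfect (𝟎 ∷ w) β ≡ true)
               (β₀₀ : β (V 0 0) ≡ not (isEven (length w)))
               (β≗β′ : ∀ x y → β (V (suc (suc x)) y) ≡ β′ (V (suc x) y)) where

    private
      e : Bool
      e = isEven (length w)
      L : List Edge
      L = edgeList w
      L₀ : List Edge
      L₀ = edgeList∖V00 w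

    Σwith-V00 : Carrier
    Σwith-V00 = Σ⊆ L₀ (λ χ → weightIf (perfect w (insert (V 0 0) χ)) (areaOf w (insert (V 0 0) χ) β′))

    Σarea-tail≈Σwith-V00 : Σarea w β′ (not e) ≈ Σwith-V00
    Σarea-tail≈Σwith-V00 = trans (Σarea-with-V00 w β′) (Σ⊆-cong L₀ (λ χ → weightIf-cong {n = areaOf w (insert (V 0 0) χ) β′}
      (≡.trans (∧-congʳ-if (perfect w (insert (V 0 0) χ)) (λ perf → ≡.cong (not e ==ᵇ_) (perp-with-V00 w (insert (V 0 0) χ) perf (insert-self (V 0 0) χ))))
               (≡.trans (≡.cong (perfect w (insert (V 0 0) χ) ∧_) (==ᵇ-refl (not e))) (∧-identityʳ _)))
      (λ _ → ≡.refl)))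

    vertical-sum : ∀ t → Σ⊆ L (weight (𝟎 ∷ w) β t ∘ prepend𝟎 false false true)
                       ≈ pow q (bit e) * (if t ==ᵇ e then Σperfect w β′ else 0#)
    vertical-sum t = begin
      Σ⊆ L (weight (𝟎 ∷ w) β t ∘ prepend𝟎 false false true)
        ≈⟨ Σ⊆-cong L (λ χ → trans (weightIf-cong (≡.cong₂ (λ p c → p ∧ (t ==ᵇ c)) (perfect-vertical𝟎 w χ) (perp-vertical𝟎 w χ))
                                                  (λ inClass → area-vertical χ (∧-trueˡ inClass)))
                                   (weightIf-+ (perfect w χ ∧ (t ==ᵇ e)) (bit e) (areaOf w χ β′))) ⟩
      Σ⊆ L (λ χ → pow q (bit e) * weightIf (perfect w χ ∧ (t ==ᵇ e)) (areaOf w χ β′))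
        ≈⟨ Σ⊆-*ˡ L (pow q (bit e)) _ ⟩
      pow q (bit e) * Σ⊆ L (λ χ → weightIf (perfect w χ ∧ (t ==ᵇ e)) (areaOf w χ β′))
        ≈⟨ *-cong refl (Σ⊆-weightIf-∧ L (perfect w) (λ χ → areaOf w χ β′) (t ==ᵇ e)) ⟩
      pow q (bit e) * (if t ==ᵇ e then Σperfect w β′ else 0#) ∎
      where
      area-vertical : ∀ χ → perfect w χ ≡ true →
        areaOf (𝟎 ∷ w) (prepend𝟎 false false true χ) β ≡ bit e ℕ.+ areaOf w χ β′
      area-vertical χ perf = ≡.trans (areaOf-vertical𝟎 w {β} {β′} perfβ β≗β′ χ perf)
        (≡.cong (λ b → bit b ℕ.+ areaOf w χ β′) (≡.trans (≡.cong not β₀₀) (not-involutive e)))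

    horizontal-sum : ∀ t → Σ⊆ L (weight (𝟎 ∷ w) β t ∘ prepend𝟎 true true false)
                         ≈ pow q (bit (not e)) * (if t ==ᵇ not e then Σwith-V00 else 0#)
    horizontal-sum t = begin
      Σ⊆ L (weight (𝟎 ∷ w) β t ∘ prepend𝟎 true true false)
        ≈⟨ Σ⊆-↭ (edgeList↭V00∷ w) (weight (𝟎 ∷ w) β t ∘ prepend𝟎 true true false) (weight-extensional (𝟎 ∷ w) β t ∘ prepend𝟎-cong) ⟩
      Σ⊆ L₀ (weight (𝟎 ∷ w) β t ∘ prepend𝟎 true true false ∘ insert (V 0 0)) + Σ⊆ L₀ (weight (𝟎 ∷ w) β t ∘ prepend𝟎 true true false)
        ≈⟨ +-dropˡ (Σ⊆-zero L₀ (λ χ → weight-imperfect (𝟎 ∷ w) β t (prepend𝟎 true true false (insert (V 0 0) χ)) (perfect-horizontal𝟎-V00 w χ))) ⟩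
      Σ⊆ L₀ (weight (𝟎 ∷ w) β t ∘ prepend𝟎 true true false)
        ≈⟨ Σ⊆-cong-supported L₀ (λ χ χ⊆ →
             trans (weightIf-cong (≡.cong₂ (λ p c → p ∧ (t ==ᵇ c)) (perfect-horizontal𝟎 w χ (V00∉ χ⊆)) (perp-horizontal𝟎 w χ))
                                  (λ inClass → area-horizontal χ (V00∉ χ⊆) (∧-trueˡ inClass)))
                   (weightIf-+ (perfect w (insert (V 0 0) χ) ∧ (t ==ᵇ not e)) (bit (not e)) (areaOf w (insert (V 0 0) χ) β′))) ⟩
      Σ⊆ L₀ (λ χ → pow q (bit (not e)) * weightIf (perfect w (insert (V 0 0) χ) ∧ (t ==ᵇ not e)) (areaOf w (insert (V 0 0) χ) β′))
        ≈⟨ Σ⊆-*ˡ L₀ (pow q (bit (not e))) _ ⟩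
      pow q (bit (not e)) * Σ⊆ L₀ (λ χ → weightIf (perfect w (insert (V 0 0) χ) ∧ (t ==ᵇ not e)) (areaOf w (insert (V 0 0) χ) β′))
        ≈⟨ *-cong refl (Σ⊆-weightIf-∧ L₀ (perfect w ∘ insert (V 0 0)) (λ χ → areaOf w (insert (V 0 0) χ) β′) (t ==ᵇ not e)) ⟩
      pow q (bit (not e)) * (if t ==ᵇ not e then Σwith-V00 else 0#) ∎
      where
      prepend𝟎-cong : ∀ {χ χ′} → (∀ e → χ e ≡ χ′ e) → ∀ e → prepend𝟎 true true false χ e ≡ prepend𝟎 true true false χ′ e
      prepend𝟎-cong χ≗χ′ (H zero zero) = ≡.refl
      prepend𝟎-cong χ≗χ′ (H zero (suc zero)) = ≡.refl
      prepend𝟎-cong χ≗χ′ (H zero (suc (suc _))) = ≡.refl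
      prepend𝟎-cong χ≗χ′ (H (suc x) y) = χ≗χ′ (H x y)
      prepend𝟎-cong χ≗χ′ (V zero zero) = ≡.refl
      prepend𝟎-cong χ≗χ′ (V zero (suc _)) = ≡.refl
      prepend𝟎-cong χ≗χ′ (V (suc x) y) = χ≗χ′ (V x y)
      V00∉ : ∀ {χ} → SupportedIn L₀ χ → χ (V 0 0) ≡ false
      V00∉ χ⊆ = ¬-not (λ V00∈χ → V00∉edgeList∖V00 w (χ⊆ V00∈χ))
      area-horizontal : ∀ χ → χ (V 0 0) ≡ false → perfect w (insert (V 0 0) χ) ≡ true →
        areaOf (𝟎 ∷ w) (prepend𝟎 true true false χ) β ≡ bit (not e) ℕ.+ areaOf w (insert (V 0 0) χ) β′
      area-horizontal χ χ₀₀ perf = ≡.trans (areaOf-horizontal𝟎 w {β} {β′} perfβ β≗β′ χ χ₀₀ perf)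
        (≡.cong (λ b → bit b ℕ.+ areaOf w (insert (V 0 0) χ) β′) β₀₀)

    full : Σarea (𝟎 ∷ w) β e ≈ pow q (bit e) * (Σarea w β′ true + Σarea w β′ false)
    full = begin
      Σarea (𝟎 ∷ w) β e
        ≈⟨ Σ⊆-𝟎 w (weight (𝟎 ∷ w) β e) (weight-extensional (𝟎 ∷ w) β e) (weight-imperfect (𝟎 ∷ w) β e) ⟩
      _ ≈⟨ +-cong (horizontal-sum e) (vertical-sum e) ⟩
      pow q (bit (not e)) * (if e ==ᵇ not e then Σwith-V00 else 0#) + pow q (bit e) * (if e ==ᵇ e then Σperfect w β′ else 0#)
        ≡⟨ ≡.cong₂ (λ a b → pow q (bit (not e)) * (if a then Σwith-V00 else 0#) + pow q (bit e) * (if b then Σperfect w β′ else 0#))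
                   (==ᵇ-not e) (==ᵇ-refl e) ⟩
      pow q (bit (not e)) * 0# + pow q (bit e) * Σperfect w β′
        ≈⟨ +-dropˡ (zeroʳ _) ⟩
      pow q (bit e) * Σperfect w β′
        ≈⟨ *-cong refl (Σperfect≈Σarea⊥+Σarea∥ w β′) ⟩
      pow q (bit e) * (Σarea w β′ true + Σarea w β′ false) ∎

    restricted : Σarea (𝟎 ∷ w) β (not e) ≈ pow q (bit (not e)) * Σarea w β′ (not e)
    restricted = begin
      Σarea (𝟎 ∷ w) β (not e)
        ≈⟨ Σ⊆-𝟎 w (weight (𝟎 ∷ w) β (not e)) (weight-extensional (𝟎 ∷ w) β (not e)) (weight-imperfect (𝟎 ∷ w) β (not e)) ⟩
      _ ≈⟨ +-cong (horizontal-sum (not e)) (vertical-sum (not e)) ⟩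
      pow q (bit (not e)) * (if not e ==ᵇ not e then Σwith-V00 else 0#) + pow q (bit e) * (if not e ==ᵇ e then Σperfect w β′ else 0#)
        ≡⟨ ≡.cong₂ (λ a b → pow q (bit (not e)) * (if a then Σwith-V00 else 0#) + pow q (bit e) * (if b then Σperfect w β′ else 0#))
                   (==ᵇ-refl (not e)) (not-==ᵇ e) ⟩
      pow q (bit (not e)) * Σwith-V00 + pow q (bit e) * 0#
        ≈⟨ +-dropʳ (zeroʳ _) ⟩
      pow q (bit (not e)) * Σwith-V00
        ≈⟨ *-cong refl Σarea-tail≈Σwith-V00 ⟨
      pow q (bit (not e)) * Σarea w β′ (not e) ∎

  module Step𝟏 (w : Word) {β β′ : EdgeSet}
               (β₁₀ : β (V 1 0) ≡ not (isEven (length w)))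
               (β≗β′ : ∀ x y → β (V x (suc y)) ≡ β′ (V x y)) where

    private
      e : Bool
      e = isEven (length w)
      L : List Edge
      L = edgeList w
      L₁ : List Edge
      L₁ = edgeList∖H00 w

    Σwith-H00 : Carrier
    Σwith-H00 = Σ⊆ L₁ (λ χ → weightIf (perfect w (insert (H 0 0) χ)) (areaOf w (insert (H 0 0) χ) β′))

    Σarea-tail≈Σwith-H00 : Σarea w β′ e ≈ Σwith-H00
    Σarea-tail≈Σwith-H00 = trans (Σarea-with-H00 w β′) (Σ⊆-cong L₁ (λ χ → weightIf-cong {n = areaOf w (insert (H 0 0) χ) β′}
      (≡.trans (∧-congʳ-if (perfect w (insert (H 0 0) χ)) (λ perf → ≡.cong (e ==ᵇ_) (perp-without-V00 w (insert (H 0 0) χ) perf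
                  (≡.trans (exactly-one _ _ (perfect⇒origin w (insert (H 0 0) χ) perf)) (≡.cong not (insert-self (H 0 0) χ))))))
               (≡.trans (≡.cong (perfect w (insert (H 0 0) χ) ∧_) (==ᵇ-refl e)) (∧-identityʳ _)))
      (λ _ → ≡.refl)))

    horizontal-sum : ∀ t → Σ⊆ L (weight (𝟏 ∷ w) β t ∘ prepend𝟏 true false false)
                         ≈ pow q (bit (not e)) * (if t ==ᵇ not e then Σperfect w β′ else 0#)
    horizontal-sum t = begin
      Σ⊆ L (weight (𝟏 ∷ w) β t ∘ prepend𝟏 true false false)
        ≈⟨ Σ⊆-cong L (λ χ → trans (weightIf-cong (≡.cong₂ (λ p c → p ∧ (t ==ᵇ c)) (perfect-horizontal𝟏 w χ) (perp-horizontal𝟏 w χ))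
                                                  (λ _ → area-horizontal χ))
                                   (weightIf-+ (perfect w χ ∧ (t ==ᵇ not e)) (bit (not e)) (areaOf w χ β′))) ⟩
      Σ⊆ L (λ χ → pow q (bit (not e)) * weightIf (perfect w χ ∧ (t ==ᵇ not e)) (areaOf w χ β′))
        ≈⟨ Σ⊆-*ˡ L (pow q (bit (not e))) _ ⟩
      pow q (bit (not e)) * Σ⊆ L (λ χ → weightIf (perfect w χ ∧ (t ==ᵇ not e)) (areaOf w χ β′))
        ≈⟨ *-cong refl (Σ⊆-weightIf-∧ L (perfect w) (λ χ → areaOf w χ β′) (t ==ᵇ not e)) ⟩
      pow q (bit (not e)) * (if t ==ᵇ not e then Σperfect w β′ else 0#) ∎
      where
      area-horizontal : ∀ χ → areaOf (𝟏 ∷ w) (prepend𝟏 true false false χ) β ≡ bit (not e) ℕ.+ areaOf w χ β′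
      area-horizontal χ = ≡.trans (areaOf-horizontal𝟏 w {β} {β′} β≗β′ χ)
        (≡.cong (λ b → bit b ℕ.+ areaOf w χ β′) β₁₀)

    vertical-sum : ∀ t → Σ⊆ L (weight (𝟏 ∷ w) β t ∘ prepend𝟏 false true true)
                       ≈ pow q (bit e) * (if t ==ᵇ e then Σwith-H00 else 0#)
    vertical-sum t = begin
      Σ⊆ L (weight (𝟏 ∷ w) β t ∘ prepend𝟏 false true true)
        ≈⟨ Σ⊆-↭ (edgeList↭H00∷ w) (weight (𝟏 ∷ w) β t ∘ prepend𝟏 false true true)
                (weight-extensional (𝟏 ∷ w) β t ∘ prepend𝟏-cong) ⟩
      Σ⊆ L₁ (weight (𝟏 ∷ w) β t ∘ prepend𝟏 false true true ∘ insert (H 0 0)) + Σ⊆ L₁ (weight (𝟏 ∷ w) β t ∘ prepend𝟏 false true true)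
        ≈⟨ +-dropˡ (Σ⊆-zero L₁ (λ χ → weight-imperfect (𝟏 ∷ w) β t (prepend𝟏 false true true (insert (H 0 0) χ))
                                                                  (perfect-vertical𝟏-H00 w χ))) ⟩
      Σ⊆ L₁ (weight (𝟏 ∷ w) β t ∘ prepend𝟏 false true true)
        ≈⟨ Σ⊆-cong-supported L₁ (λ χ χ⊆ →
             trans (weightIf-cong (≡.cong₂ (λ p c → p ∧ (t ==ᵇ c)) (perfect-vertical𝟏 w χ (H00∉ χ⊆)) (perp-vertical𝟏 w χ))
                                  (λ _ → area-vertical χ))
                   (weightIf-+ (perfect w (insert (H 0 0) χ) ∧ (t ==ᵇ e)) (bit e) (areaOf w (insert (H 0 0) χ) β′))) ⟩
      Σ⊆ L₁ (λ χ → pow q (bit e) * weightIf (perfect w (insert (H 0 0) χ) ∧ (t ==ᵇ e)) (areaOf w (insert (H 0 0) χ) β′))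
        ≈⟨ Σ⊆-*ˡ L₁ (pow q (bit e)) _ ⟩
      pow q (bit e) * Σ⊆ L₁ (λ χ → weightIf (perfect w (insert (H 0 0) χ) ∧ (t ==ᵇ e)) (areaOf w (insert (H 0 0) χ) β′))
        ≈⟨ *-cong refl (Σ⊆-weightIf-∧ L₁ (perfect w ∘ insert (H 0 0)) (λ χ → areaOf w (insert (H 0 0) χ) β′) (t ==ᵇ e)) ⟩
      pow q (bit e) * (if t ==ᵇ e then Σwith-H00 else 0#) ∎
      where
      prepend𝟏-cong : ∀ {χ χ′} → (∀ e → χ e ≡ χ′ e) → ∀ e → prepend𝟏 false true true χ e ≡ prepend𝟏 false true true χ′ e
      prepend𝟏-cong χ≗χ′ (H x (suc y)) = χ≗χ′ (H x y)
      prepend𝟏-cong χ≗χ′ (H zero zero) = ≡.refl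
      prepend𝟏-cong χ≗χ′ (H (suc _) zero) = ≡.refl
      prepend𝟏-cong χ≗χ′ (V x (suc y)) = χ≗χ′ (V x y)
      prepend𝟏-cong χ≗χ′ (V zero zero) = ≡.refl
      prepend𝟏-cong χ≗χ′ (V (suc zero) zero) = ≡.refl
      prepend𝟏-cong χ≗χ′ (V (suc (suc _)) zero) = ≡.refl
      H00∉ : ∀ {χ} → SupportedIn L₁ χ → χ (H 0 0) ≡ false
      H00∉ χ⊆ = ¬-not (λ H00∈χ → H00∉edgeList∖H00 w (χ⊆ H00∈χ))
      area-vertical : ∀ χ → areaOf (𝟏 ∷ w) (prepend𝟏 false true true χ) β ≡ bit e ℕ.+ areaOf w (insert (H 0 0) χ) β′
      area-vertical χ = ≡.trans (areaOf-vertical𝟏 w {β} {β′} β≗β′ χ)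
        (≡.cong (λ b → bit b ℕ.+ areaOf w (insert (H 0 0) χ) β′) (≡.trans (≡.cong not β₁₀) (not-involutive e)))

    full : Σarea (𝟏 ∷ w) β (not e) ≈ pow q (bit (not e)) * (Σarea w β′ true + Σarea w β′ false)
    full = begin
      Σarea (𝟏 ∷ w) β (not e)
        ≈⟨ Σ⊆-𝟏 w (weight (𝟏 ∷ w) β (not e)) (weight-extensional (𝟏 ∷ w) β (not e)) (weight-imperfect (𝟏 ∷ w) β (not e)) ⟩
      _ ≈⟨ +-cong (horizontal-sum (not e)) (vertical-sum (not e)) ⟩
      pow q (bit (not e)) * (if not e ==ᵇ not e then Σperfect w β′ else 0#) + pow q (bit e) * (if not e ==ᵇ e then Σwith-H00 else 0#)
        ≡⟨ ≡.cong₂ (λ a b → pow q (bit (not e)) * (if a then Σperfect w β′ else 0#) + pow q (bit e) * (if b then Σwith-H00 else 0#))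
                   (==ᵇ-refl (not e)) (not-==ᵇ e) ⟩
      pow q (bit (not e)) * Σperfect w β′ + pow q (bit e) * 0#
        ≈⟨ +-dropʳ (zeroʳ _) ⟩
      pow q (bit (not e)) * Σperfect w β′
        ≈⟨ *-cong refl (Σperfect≈Σarea⊥+Σarea∥ w β′) ⟩
      pow q (bit (not e)) * (Σarea w β′ true + Σarea w β′ false) ∎

    restricted : Σarea (𝟏 ∷ w) β e ≈ pow q (bit e) * Σarea w β′ e
    restricted = begin
      Σarea (𝟏 ∷ w) β e
        ≈⟨ Σ⊆-𝟏 w (weight (𝟏 ∷ w) β e) (weight-extensional (𝟏 ∷ w) β e) (weight-imperfect (𝟏 ∷ w) β e) ⟩
      _ ≈⟨ +-cong (horizontal-sum e) (vertical-sum e) ⟩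
      pow q (bit (not e)) * (if e ==ᵇ not e then Σperfect w β′ else 0#) + pow q (bit e) * (if e ==ᵇ e then Σwith-H00 else 0#)
        ≡⟨ ≡.cong₂ (λ a b → pow q (bit (not e)) * (if a then Σperfect w β′ else 0#) + pow q (bit e) * (if b then Σwith-H00 else 0#))
                   (==ᵇ-not e) (==ᵇ-refl e) ⟩
      pow q (bit (not e)) * 0# + pow q (bit e) * Σwith-H00
        ≈⟨ +-dropˡ (zeroʳ _) ⟩
      pow q (bit e) * Σwith-H00
        ≈⟨ *-cong refl Σarea-tail≈Σwith-H00 ⟨
      pow q (bit e) * Σarea w β′ e ∎

  _≈²_ : Carrier × Carrier → Carrier × Carrier → Set ℓ
  (a , b) ≈² (c , d) = a ≈ c × b ≈ d

  ≈²-trans : ∀ {u v w} → u ≈² v → v ≈² w → u ≈² w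
  ≈²-trans (a≈c , b≈d) (c≈e , d≈f) = trans a≈c c≈e , trans b≈d d≈f

  ▹-cong : ∀ M {u v} → u ≈² v → (M ▹ u) ≈² (M ▹ v)
  ▹-cong (mat a b c d) (x≈x′ , y≈y′) = +-cong (*-cong refl x≈x′) (*-cong refl y≈y′) , +-cong (*-cong refl x≈x′) (*-cong refl y≈y′)

  ·-▹ : ∀ M N v → ((M · N) ▹ v) ≈² (M ▹ (N ▹ v))
  ·-▹ (mat a b c d) (mat a′ b′ c′ d′) (x , y) = row a b , row c d
    where
    row : ∀ a b → (a * a′ + b * c′) * x + (a * b′ + b * d′) * y ≈ a * (a′ * x + b′ * y) + b * (c′ * x + d′ * y)
    row a b = begin
      (a * a′ + b * c′) * x + (a * b′ + b * d′) * y
        ≈⟨ +-cong (distribʳ x _ _) (distribʳ y _ _) ⟩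
      (a * a′ * x + b * c′ * x) + (a * b′ * y + b * d′ * y)
        ≈⟨ interchange _ _ _ _ ⟩
      (a * a′ * x + a * b′ * y) + (b * c′ * x + b * d′ * y)
        ≈⟨ +-cong (+-cong (*-assoc a a′ x) (*-assoc a b′ y)) (+-cong (*-assoc b c′ x) (*-assoc b d′ y)) ⟩
      (a * (a′ * x) + a * (b′ * y)) + (b * (c′ * x) + b * (d′ * y))
        ≈⟨ +-cong (distribˡ a _ _) (distribˡ b _ _) ⟨
      a * (a′ * x + b′ * y) + b * (c′ * x + d′ * y) ∎

  classVector : Word → EdgeSet → Carrier × Carrier
  classVector w β = Σarea w β true , q * Σarea w β false

  transfer : ∀ r {T T′ : Bool → Carrier} →
    T (not r) ≈ pow q (bit (not r)) * (T′ true + T′ false) → T r ≈ pow q (bit r) * T′ r →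
    (T true , q * T false) ≈² (νL q (letter r) ▹ (T′ true , q * T′ false))
  transfer true {T} {T′} T∥ T⊥ =
    (begin
      T true                          ≈⟨ T⊥ ⟩
      (q * 1#) * T′ true              ≈⟨ *-cong (*-identityʳ q) refl ⟩
      q * T′ true                     ≈⟨ +-identityʳ _ ⟨
      q * T′ true + 0#                ≈⟨ +-cong refl (zeroˡ _) ⟨
      q * T′ true + 0# * (q * T′ false) ∎) ,
    (begin
      q * T false                     ≈⟨ *-cong refl (trans T∥ (*-identityˡ _)) ⟩
      q * (T′ true + T′ false)        ≈⟨ distribˡ q _ _ ⟩
      q * T′ true + q * T′ false      ≈⟨ +-cong refl (*-identityˡ _) ⟨
      q * T′ true + 1# * (q * T′ false) ∎)
  transfer false {T} {T′} T⊥ T∥ =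
    (begin
      T true                          ≈⟨ T⊥ ⟩
      (q * 1#) * (T′ true + T′ false) ≈⟨ *-cong (*-identityʳ q) refl ⟩
      q * (T′ true + T′ false)        ≈⟨ distribˡ q _ _ ⟩
      q * T′ true + q * T′ false      ≈⟨ +-cong refl (*-identityˡ _) ⟨
      q * T′ true + 1# * (q * T′ false) ∎) ,
    (begin
      q * T false                     ≈⟨ *-cong refl (trans T∥ (*-identityˡ _)) ⟩
      q * T′ false                    ≈⟨ *-identityˡ _ ⟨
      1# * (q * T′ false)             ≈⟨ +-identityˡ _ ⟨
      0# + 1# * (q * T′ false)        ≈⟨ +-cong (zeroˡ _) refl ⟨
      0# * T′ true + 1# * (q * T′ false) ∎)

  ≈²-sym : ∀ {u v} → u ≈² v → v ≈² u
  ≈²-sym (a≈c , b≈d) = sym a≈c , sym b≈d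

  Σarea-congᴸ : ∀ w {β β′ : EdgeSet} t → (∀ {e} → e ∈ edgeList w → β e ≡ β′ e) → Σarea w β t ≈ Σarea w β′ t
  Σarea-congᴸ w t β≗β′ = Σ⊆-cong (edgeList w) (λ χ → reflexive (≡.cong (weightIf _) (areaOf-congᴸ w χ β≗β′)))

  basic[] : EdgeSet
  basic[] = insert (V 0 0) (insert (V 1 0) (λ _ → false))

  -- Of the 16 subsets of the edges of the unit square, only {H00, H01} (class ⊥,
  -- area 1) and {V00, V10} (class ∥, area 0) are perfect matchings.
  single-square : Σarea [] basic[] true ≈ q × Σarea [] basic[] false ≈ 1#
  single-square =
    trans (+-dropʳ z₈) (trans (+-dropʳ z₄) (trans (+-dropˡ z₂) (trans (+-identityˡ _) (*-identityʳ q)))) ,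
    trans (+-dropˡ z₈) (trans (+-dropˡ z₄) (trans (+-dropʳ z₂) (+-identityʳ 1#)))
    where
    z₂ : 0# + 0# ≈ 0#
    z₂ = +-identityˡ 0#
    z₄ : (0# + 0#) + (0# + 0#) ≈ 0#
    z₄ = trans (+-cong z₂ z₂) z₂
    z₈ : ((0# + 0#) + (0# + 0#)) + ((0# + 0#) + (0# + 0#)) ≈ 0#
    z₈ = trans (+-cong z₄ z₄) z₂

  classVector-[] : ∀ {β} → Basic [] β → classVector [] β ≈² (ν q [] ▹ (q , q))
  classVector-[] {β} bβ with split[] β (perfect-basic bβ)
  ... | horizontal _ _ _ v₁₀ with () ← ≡.trans (≡.sym v₁₀) (contains-last bβ)
  ... | vertical h₀₀ h₀₁ v₀₀ v₁₀ =
    (begin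
      Σarea [] β true                ≈⟨ Σarea-congᴸ [] true agrees ⟩
      Σarea [] basic[] true          ≈⟨ proj₁ single-square ⟩
      q                              ≈⟨ trans (+-cong (*-identityˡ q) (zeroˡ q)) (+-identityʳ q) ⟨
      1# * q + 0# * q                ∎) ,
    (begin
      q * Σarea [] β false           ≈⟨ *-cong refl (trans (Σarea-congᴸ [] false agrees) (proj₂ single-square)) ⟩
      q * 1#                         ≈⟨ *-identityʳ q ⟩
      q                              ≈⟨ trans (+-cong (zeroˡ q) (*-identityˡ q)) (+-identityˡ q) ⟨
      0# * q + 1# * q                ∎)
    where
    agrees : ∀ {e} → e ∈ edgeList [] → β e ≡ basic[] e
    agrees (here ≡.refl) = h₀₀
    agrees (there (here ≡.refl)) = h₀₁
    agrees (there (there (here ≡.refl))) = v₀₀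
    agrees (there (there (there (here ≡.refl)))) = v₁₀

  classVector-θ : ∀ w {β} → Basic w β → classVector w β ≈² (ν q (θ w) ▹ (q , q))
  classVector-θ [] bβ = classVector-[] bβ
  classVector-θ (𝟎 ∷ w) {β} bβ rewrite θ-𝟎 w with basic-tail-𝟎 bβ
  ... | β′ , bβ′ , β≗β′ =
    ≈²-trans (transfer (not e) {Σarea (𝟎 ∷ w) β} {Σarea w β′} full′ restricted)
             (≈²-trans (▹-cong (νL q (letter (not e))) (classVector-θ w bβ′))
                       (≈²-sym (·-▹ (νL q (letter (not e))) (ν q (θ w)) (q , q))))
    where
    e : Bool
    e = isEven (length w)
    open Step𝟎 w {β} {β′} (perfect-basic bβ) (≡.trans (basic-V00 (𝟎 ∷ w) bβ) (isEven-suc (length w))) β≗β′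
    full′ : Σarea (𝟎 ∷ w) β (not (not e)) ≈ pow q (bit (not (not e))) * (Σarea w β′ true + Σarea w β′ false)
    full′ = ≡.subst (λ f → Σarea (𝟎 ∷ w) β f ≈ pow q (bit f) * (Σarea w β′ true + Σarea w β′ false))
                    (≡.sym (not-involutive e)) full
  classVector-θ (𝟏 ∷ w) {β} bβ rewrite θ-𝟏 w with basic-tail-𝟏 bβ
  ... | β′ , bβ′ , β≗β′ =
    ≈²-trans (transfer e {Σarea (𝟏 ∷ w) β} {Σarea w β′} full restricted)
             (≈²-trans (▹-cong (νL q (letter e)) (classVector-θ w bβ′))
                       (≈²-sym (·-▹ (νL q (letter e)) (ν q (θ w)) (q , q))))
    where
    e : Bool
    e = isEven (length w)
    open Step𝟏 w {β} {β′} (≡.trans (basic-V10-𝟏 w bβ) (isEven-suc (length w))) β≗β′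

  unscale : ∀ q⁻¹ → q * q⁻¹ ≈ 1# → ∀ {x y u} → (x , q * y) ≈² u → (x , y) ≈² (mat 1# 0# 0# q⁻¹ ▹ u)
  unscale q⁻¹ qq⁻¹≈1 {x} {y} {u₁ , u₂} (x≈u₁ , qy≈u₂) =
    (begin
      x                     ≈⟨ x≈u₁ ⟩
      u₁                    ≈⟨ trans (+-cong (*-identityˡ u₁) (zeroˡ u₂)) (+-identityʳ u₁) ⟨
      1# * u₁ + 0# * u₂     ∎) ,
    (begin
      y                     ≈⟨ *-identityˡ y ⟨
      1# * y                ≈⟨ *-cong (trans (*-comm q⁻¹ q) qq⁻¹≈1) refl ⟨
      (q⁻¹ * q) * y         ≈⟨ *-assoc q⁻¹ q y ⟩
      q⁻¹ * (q * y)         ≈⟨ *-cong refl qy≈u₂ ⟩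
      q⁻¹ * u₂              ≈⟨ trans (+-cong (zeroˡ u₁) refl) (+-identityˡ _) ⟨
      0# * u₁ + q⁻¹ * u₂    ∎)

proposition9p1 : ∀ {c ℓ} (R : CommutativeRing c ℓ) →
    let open CommutativeRing R
        open OverRing R
    in (q q⁻¹ : Carrier) → q * q⁻¹ ≈ 1# →
       (w : Word) (b : List Edge) → IsBasicMatching w b →
       (areaSum q w b (M⊥ w) ≈ proj₁ (rhs q q⁻¹ w))
       × (areaSum q w b (M∥ w) ≈ proj₂ (rhs q q⁻¹ w))
proposition9p1 R q q⁻¹ qq⁻¹≈1 w b bm =
  trans (areaSum≈Σarea w b true) (proj₁ classes) , trans (areaSum≈Σarea w b false) (proj₂ classes)
  where
  open CommutativeRing R using (trans)
  open OverRing R using (rhs)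
  open AreaSums R q
  classes : (Σarea w (_∈ᵇ b) true , Σarea w (_∈ᵇ b) false) ≈² rhs q q⁻¹ w
  classes = unscale q⁻¹ qq⁻¹≈1 (classVector-θ w (Matchings.isBasicMatching⇒Basic w b bm))
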